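{- For $n,k\ge0$ let $i_{n,k}$ be the number of intervals $[P,Q]$ in $\mathbb{F}_n^\infty$ such that the length of the first ascent of $Q$ minus the length of the first ascent of $P$ equals $k$. Then $$\sum_{n,k\ge0}i_{n,k}x^ny^k=1+\frac{2x}{1-2x-2xy+\sqrt{1-4x}}.$$ In particular the generating function of the number of intervals of $\mathbb{F}_n^\infty$ is $\frac12\left(1+\frac{1}{\sqrt{1-4x}}\right)$, and for $n\ge1$ the number of intervals of $\mathbb{F}_n^\infty$ is $\binom{2n-1}{n}$.
   Context: A Dyck path of semilength $n\ge 0$ is a lattice path from $(0,0)$ to $(2n,0)$ with steps $U=(1,1)$ and $D=(1,-1)$ that never goes below the $x$-axis; it is identified with its word over $\{U,D\}$. A path avoids a pattern $\alpha$ if $\alpha$ does not occur as a factor (block of consecutive steps). $\mathcal{F}_n^\infty$ is the set of Dyck paths of semilength $n$ avoiding $DUU$, ordered by the Stanley order: $P\le Q$ iff $P$ lies weakly below $Q$ when both are drawn in the plane; $\mathbb{F}_n^\infty=(\mathcal{F}_n^\infty,\le)$. An interval is $[P,Q]=\{R:P\le R\le Q\}$ with $P\le Q$ (including $P=Q$). The first ascent of a nonempty Dyck path is its maximal initial run of $U$ steps; for the empty path take its length to be $0$. -}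

module Defs where

open import Data.Bool using (Bool; true; false; _∧_)
open import Data.Nat using (ℕ; zero; suc; _+_; _≤ᵇ_; _≡ᵇ_)
open import Data.Integer as ℤ using (ℤ; +_; -[1+_])
open import Data.List using (List; []; _∷_; map; concatMap; filter; length; cartesianProduct; upTo; sum; foldr)
open import Data.Product using (_×_; _,_; proj₁; proj₂)
open import Relation.Nullary.Decidable using (Dec; yes; no)
open import Relation.Binary.PropositionalEquality using (_≡_; refl)

data Step : Set where
  U D : Step

words : ℕ → List (List Step)
words zero    = [] ∷ []
words (suc m) = concatMap (λ w → (U ∷ w) ∷ (D ∷ w) ∷ []) (words m)

dyckFrom : ℕ → List Step → Bool
dyckFrom zero    []      = true
dyckFrom (suc _) []      = false
dyckFrom h       (U ∷ w) = dyckFrom (suc h) w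
dyckFrom zero    (D ∷ w) = false
dyckFrom (suc h) (D ∷ w) = dyckFrom h w

isDyck : List Step → Bool
isDyck = dyckFrom 0

avoidsDUU : List Step → Bool
avoidsDUU []              = true
avoidsDUU (D ∷ U ∷ U ∷ w) = false
avoidsDUU (_ ∷ w)         = avoidsDUU w

Fset : ℕ → List (List Step)
Fset n = filter (λ w → Data.Bool._≟_ (isDyck w ∧ avoidsDUU w) true) (words (n + n))
  where import Data.Bool

-- heights after each step, starting from height h (natural truncated
-- subtraction is harmless since only Dyck paths are compared)
heightsFrom : ℕ → List Step → List ℕ
heightsFrom h []      = []
heightsFrom h (U ∷ w) = suc h ∷ heightsFrom (suc h) w
heightsFrom h (D ∷ w) = Data.Nat._∸_ h 1 ∷ heightsFrom (Data.Nat._∸_ h 1) w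
  where import Data.Nat

pointwiseLeq : List ℕ → List ℕ → Bool
pointwiseLeq []       []       = true
pointwiseLeq (a ∷ as) (b ∷ bs) = (a ≤ᵇ b) ∧ pointwiseLeq as bs
pointwiseLeq _        _        = false

stanleyLeq : List Step → List Step → Bool
stanleyLeq P Q = pointwiseLeq (heightsFrom 0 P) (heightsFrom 0 Q)

firstAscent : List Step → ℕ
firstAscent (U ∷ w) = suc (firstAscent w)
firstAscent _       = 0

private
  isTrue? : (b : Bool) → Dec (b ≡ true)
  isTrue? true  = yes refl
  isTrue? false = no (λ ())

countPairs : (List Step → List Step → Bool) → ℕ → ℕ
countPairs p n = length (filter (λ PQ → isTrue? (p (proj₁ PQ) (proj₂ PQ)))
                                (cartesianProduct (Fset n) (Fset n)))

iNK : ℕ → ℕ → ℕ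
iNK n k = countPairs (λ P Q → stanleyLeq P Q ∧ (firstAscent Q ≡ᵇ (firstAscent P + k))) n

intervals : ℕ → ℕ
intervals = countPairs stanleyLeq

PS1 : Set
PS1 = ℕ → ℤ

PS2 : Set
PS2 = ℕ → ℕ → ℤ

sumTo : ℕ → (ℕ → ℤ) → ℤ
sumTo n f = foldr ℤ._+_ (+ 0) (map f (upTo (suc n)))

_*₁_ : PS1 → PS1 → PS1
(A *₁ B) n = sumTo n (λ a → A a ℤ.* B (Data.Nat._∸_ n a))
  where import Data.Nat

_*₂_ : PS2 → PS2 → PS2
(A *₂ B) n k = sumTo n (λ a → sumTo k (λ b →
                 A a b ℤ.* B (Data.Nat._∸_ n a) (Data.Nat._∸_ k b)))
  where import Data.Nat

_≈₁_ : PS1 → PS1 → Set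
A ≈₁ B = ∀ n → A n ≡ B n

_≈₂_ : PS2 → PS2 → Set
A ≈₂ B = ∀ n k → A n k ≡ B n k

oneMinus4x : PS1
oneMinus4x 0 = + 1
oneMinus4x 1 = ℤ.- (+ 4)
oneMinus4x _ = + 0

oneMinus4x₂ : PS2
oneMinus4x₂ 0 0 = + 1
oneMinus4x₂ 1 0 = ℤ.- (+ 4)
oneMinus4x₂ _ _ = + 0

poly1 : PS2
poly1 0 0 = + 1
poly1 1 0 = ℤ.- (+ 2)
poly1 1 1 = ℤ.- (+ 2)
poly1 _ _ = + 0

twoX : PS2
twoX 1 0 = + 2
twoX _ _ = + 0

iSeriesMinus1 : PS2
iSeriesMinus1 0 0 = ℤ._-_ (+ iNK 0 0) (+ 1)
iSeriesMinus1 n k = + iNK n k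

intervalSeries : PS1
intervalSeries n = + intervals n

if0 : ℕ → ℤ
if0 0 = + 1
if0 _ = + 0

{-# OPTIONS --safe #-}
-- A DUU-avoiding Dyck path of semilength n + 1 is U^(1+d) D followed by a word in the blocks UD and D,
-- d of which are D; it is coded by that word b ∈ {U,D}ⁿ, and path b ≤ path b′ iff every suffix of b has
-- at most as many D's as the suffix of b′ of the same length. Splitting on the first letters of b and b′
-- gives, for the columns Rₖ = Σ_{n ≥ 1} i_{n,k} xⁿ, the system Rₖ = x (δₖ₀ + 2 Rₖ + Rₖ₊₁ + Rₖ₋₁), and
-- for the numbers Tₙ of intervals, T_{n+2} = 4 T_{n+1} − i_{n+1,0}. Such a system determines its
-- solution from the forcing term, and (R_{k+1})ₖ and (R₀ Rₖ)ₖ solve it with forcing term R₀ at k = 0;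
-- hence R_{k+1} = R₀ Rₖ and r = R₀ satisfies r = x (1 + r)². Then √(1 − 4x) = 1 − 2x − 2x r, as square
-- roots with constant term 1 are unique, and both generating-function identities become polynomial
-- identities in x and r, up to cancelling a series with nonzero constant term. The closed form
-- i_{n+1,k} = C(2n+1, n+k+1) − C(2n+1, n+k+2) follows from the same recurrence by Pascal's rule and
-- gives Tₙ = C(2n−1, n).

module Submission where

open import Defs
open import Relation.Binary.PropositionalEquality

module FiniteSums where

  open import Data.Bool using (Bool; true; false; if_then_else_)
  open import Data.Empty using (⊥-elim)
  open import Data.List using (List; []; _∷_; _++_; map; concat; filter; length; cartesianProduct)
  open import Data.Nat using (ℕ; suc; _+_)
  open import Data.Nat.Properties using (+-assoc)
  open import Data.Nat.Tactic.RingSolver using (solve-∀)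
  open import Data.Product using (_,_)
  open import Relation.Nullary using (Dec; yes; no)

  private variable A B : Set

  ∑ : List A → (A → ℕ) → ℕ
  ∑ []       f = 0
  ∑ (x ∷ xs) f = f x + ∑ xs f

  syntax ∑ xs (λ x → e) = ∑[ x ∈ xs ] e

  ∑-cong : ∀ xs {f g : A → ℕ} → (∀ x → f x ≡ g x) → ∑ xs f ≡ ∑ xs g
  ∑-cong []       f≗g = refl
  ∑-cong (x ∷ xs) f≗g = cong₂ _+_ (f≗g x) (∑-cong xs f≗g)

  ∑-zero : ∀ (xs : List A) → ∑[ x ∈ xs ] 0 ≡ 0
  ∑-zero []       = refl
  ∑-zero (x ∷ xs) = ∑-zero xs

  ∑-+ : ∀ xs (f g : A → ℕ) → ∑[ x ∈ xs ] (f x + g x) ≡ ∑ xs f + ∑ xs g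
  ∑-+ []       f g = refl
  ∑-+ (x ∷ xs) f g rewrite ∑-+ xs f g = interchange (f x) (g x) (∑ xs f) (∑ xs g)
    where
    interchange : ∀ a b c d → a + b + (c + d) ≡ a + c + (b + d)
    interchange = solve-∀

  ∑-++ : ∀ xs ys (f : A → ℕ) → ∑ (xs ++ ys) f ≡ ∑ xs f + ∑ ys f
  ∑-++ []       ys f = refl
  ∑-++ (x ∷ xs) ys f = trans (cong (f x +_) (∑-++ xs ys f)) (sym (+-assoc (f x) _ _))

  ∑-map : ∀ (g : A → B) xs f → ∑ (map g xs) f ≡ ∑[ x ∈ xs ] f (g x)
  ∑-map g []       f = refl
  ∑-map g (x ∷ xs) f = cong (f (g x) +_) (∑-map g xs f)

  ∑-concat : ∀ xss (f : A → ℕ) → ∑ (concat xss) f ≡ ∑[ xs ∈ xss ] ∑ xs f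
  ∑-concat []         f = refl
  ∑-concat (xs ∷ xss) f = trans (∑-++ xs (concat xss) f) (cong (∑ xs f +_) (∑-concat xss f))

  ∑-swap : ∀ (xs : List A) (ys : List B) (f : A → B → ℕ) →
           ∑[ x ∈ xs ] ∑[ y ∈ ys ] f x y ≡ ∑[ y ∈ ys ] ∑[ x ∈ xs ] f x y
  ∑-swap []       ys f = sym (∑-zero ys)
  ∑-swap (x ∷ xs) ys f = trans (cong (∑ ys (f x) +_) (∑-swap xs ys f)) (sym (∑-+ ys (f x) (λ y → ∑[ x ∈ xs ] f x y)))

  ∑-cartesianProduct : ∀ (xs : List A) (ys : List B) f →
                       ∑ (cartesianProduct xs ys) f ≡ ∑[ x ∈ xs ] ∑[ y ∈ ys ] f (x , y)
  ∑-cartesianProduct []       ys f = refl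
  ∑-cartesianProduct (x ∷ xs) ys f = trans (∑-++ (map (x ,_) ys) _ f)
    (cong₂ _+_ (∑-map (x ,_) ys f) (∑-cartesianProduct xs ys f))

  ∑-filter : ∀ (p : A → Bool) (p? : ∀ x → Dec (p x ≡ true)) xs f →
             ∑ (filter p? xs) f ≡ ∑[ x ∈ xs ] (if p x then f x else 0)
  ∑-filter p p? []       f = refl
  ∑-filter p p? (x ∷ xs) f with p x | p? x
  ... | true  | yes _ = cong (f x +_) (∑-filter p p? xs f)
  ... | true  | no ¬t = ⊥-elim (¬t refl)
  ... | false | no _  = ∑-filter p p? xs f

  length≡∑ : ∀ (xs : List A) → length xs ≡ ∑[ x ∈ xs ] 1
  length≡∑ []       = refl
  length≡∑ (x ∷ xs) = cong suc (length≡∑ xs)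

module Words where

  open FiniteSums
  open import Data.Bool using (if_then_else_)
  open import Data.List using (List; []; _∷_; map; length)
  open import Data.List.Properties using (≡-dec)
  open import Data.Nat using (ℕ; zero; suc; _+_)
  open import Data.Nat.Properties using (+-identityʳ; suc-injective)
  open import Relation.Binary.Definitions using (DecidableEquality)
  open import Relation.Nullary using (yes; no; does)

  ∑-words-suc : ∀ n (f : List Step → ℕ) → ∑ (words (suc n)) f ≡ ∑[ w ∈ words n ] (f (U ∷ w) + f (D ∷ w))
  ∑-words-suc n f = trans (∑-concat (map _ (words n)) f) (trans (∑-map _ (words n) _)
    (∑-cong (words n) (λ w → cong (f (U ∷ w) +_) (+-identityʳ (f (D ∷ w))))))

  ∑-words-split : ∀ n (f : List Step → ℕ) →
                  ∑ (words (suc n)) f ≡ ∑[ w ∈ words n ] f (U ∷ w) + ∑[ w ∈ words n ] f (D ∷ w)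
  ∑-words-split n f = trans (∑-words-suc n f) (∑-+ (words n) _ _)

  ∑-words-cong : ∀ n {f g : List Step → ℕ} → (∀ w → length w ≡ n → f w ≡ g w) →
                 ∑ (words n) f ≡ ∑ (words n) g
  ∑-words-cong zero    f≗g = cong (_+ 0) (f≗g [] refl)
  ∑-words-cong (suc n) {f} {g} f≗g = trans (∑-words-suc n f) (trans
    (∑-words-cong n (λ w |w| → cong₂ _+_ (f≗g (U ∷ w) (cong suc |w|)) (f≗g (D ∷ w) (cong suc |w|))))
    (sym (∑-words-suc n g)))

  _≟ₛ_ : DecidableEquality Step
  U ≟ₛ U = yes refl
  D ≟ₛ D = yes refl
  U ≟ₛ D = no λ ()
  D ≟ₛ U = no λ ()

  _≟ʷ_ : DecidableEquality (List Step)
  _≟ʷ_ = ≡-dec _≟ₛ_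

  ∑-words-select : ∀ n v (f : List Step → ℕ) → length v ≡ n →
                   ∑[ w ∈ words n ] (if does (w ≟ʷ v) then f w else 0) ≡ f v
  ∑-words-select zero    []      f refl = +-identityʳ (f [])
  ∑-words-select (suc n) (U ∷ v) f |v| = trans (∑-words-suc n _) (trans
    (∑-cong (words n) (λ w → +-identityʳ _)) (∑-words-select n v (λ w → f (U ∷ w)) (suc-injective |v|)))
  ∑-words-select (suc n) (D ∷ v) f |v| = trans (∑-words-suc n _)
    (∑-words-select n v (λ w → f (D ∷ w)) (suc-injective |v|))

module Paths where

  open import Data.Bool using (Bool; true; _∧_)
  open import Data.List using (List; []; _∷_; _++_; replicate; length)
  open import Data.Nat using (ℕ; zero; suc; _+_)
  open import Data.Nat.Properties using (+-suc; +-comm; suc-injective)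
  open import Data.List.Properties using (length-++; length-replicate)
  open import Data.Product using (_×_; _,_)
  open import Function using (_∘_)
  open ≡-Reasoning

  downs : List Step → ℕ
  downs []      = 0
  downs (U ∷ b) = downs b
  downs (D ∷ b) = suc (downs b)

  expand : List Step → List Step
  expand []      = []
  expand (U ∷ b) = U ∷ D ∷ expand b
  expand (D ∷ b) = D ∷ expand b

  -- After its first descent a DUU-avoiding Dyck path never rises twice in a row, so it consists of an
  -- ascent, one D, and blocks UD and D; the code b lists the blocks, U standing for UD.
  path : List Step → List Step
  path b = replicate (suc (downs b)) U ++ D ∷ expand b

  contract : List Step → List Step
  contract (D ∷ t)     = D ∷ contract t
  contract (U ∷ D ∷ t) = U ∷ contract t
  contract _           = []

  code : List Step → List Step
  code []      = []
  code (U ∷ w) = code w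
  code (D ∷ t) = contract t

  good : List Step → Bool
  good w = isDyck w ∧ avoidsDUU w

  contract-expand : ∀ b → contract (expand b) ≡ b
  contract-expand []      = refl
  contract-expand (U ∷ b) = cong (U ∷_) (contract-expand b)
  contract-expand (D ∷ b) = cong (D ∷_) (contract-expand b)

  code-path : ∀ b → code (path b) ≡ b
  code-path b = trans (code-ascent (suc (downs b))) (contract-expand b)
    where
    code-ascent : ∀ k → code (replicate k U ++ D ∷ expand b) ≡ contract (expand b)
    code-ascent zero    = refl
    code-ascent (suc k) = code-ascent k

  dyckFrom-U : ∀ h w → dyckFrom h (U ∷ w) ≡ dyckFrom (suc h) w
  dyckFrom-U zero    w = refl
  dyckFrom-U (suc h) w = refl

  dyckFrom-ascent : ∀ h k w → dyckFrom h (replicate k U ++ w) ≡ dyckFrom (k + h) w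
  dyckFrom-ascent h zero    w = refl
  dyckFrom-ascent h (suc k) w = trans (dyckFrom-U h _)
    (trans (dyckFrom-ascent (suc h) k w) (cong (λ h′ → dyckFrom h′ w) (+-suc k h)))

  avoidsDUU-ascent : ∀ k w → avoidsDUU (replicate k U ++ w) ≡ avoidsDUU w
  avoidsDUU-ascent zero    w = refl
  avoidsDUU-ascent (suc k) w = avoidsDUU-ascent k w

  dyckFrom-expand : ∀ b → dyckFrom (downs b) (expand b) ≡ true
  dyckFrom-expand []      = refl
  dyckFrom-expand (U ∷ b) = trans (dyckFrom-U (downs b) _) (dyckFrom-expand b)
  dyckFrom-expand (D ∷ b) = dyckFrom-expand b

  avoidsDUU-expand : ∀ b → avoidsDUU (D ∷ expand b) ≡ true
  avoidsDUU-expand []      = refl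
  avoidsDUU-expand (U ∷ b) = avoidsDUU-expand b
  avoidsDUU-expand (D ∷ b) = avoidsDUU-expand b

  isDyck-path : ∀ b → isDyck (path b) ≡ true
  isDyck-path b = trans (dyckFrom-ascent 0 (suc (downs b)) _)
    (trans (cong (λ h → dyckFrom h (D ∷ expand b)) (+-comm (suc (downs b)) 0)) (dyckFrom-expand b))

  good-path : ∀ b → good (path b) ≡ true
  good-path b rewrite isDyck-path b = trans (avoidsDUU-ascent (suc (downs b)) _) (avoidsDUU-expand b)

  downs+length-expand : ∀ b → downs b + length (expand b) ≡ length b + length b
  downs+length-expand []      = refl
  downs+length-expand (U ∷ b) = begin
    downs b + suc (suc (length (expand b)))  ≡⟨ +-suc (downs b) _ ⟩
    suc (downs b + suc (length (expand b)))  ≡⟨ cong suc (+-suc (downs b) _) ⟩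
    suc (suc (downs b + length (expand b)))  ≡⟨ cong (suc ∘ suc) (downs+length-expand b) ⟩
    suc (suc (length b + length b))          ≡⟨ cong suc (+-suc (length b) _) ⟨
    suc (length b + suc (length b))          ∎
  downs+length-expand (D ∷ b) = begin
    suc (downs b + suc (length (expand b)))  ≡⟨ cong suc (+-suc (downs b) _) ⟩
    suc (suc (downs b + length (expand b)))  ≡⟨ cong (suc ∘ suc) (downs+length-expand b) ⟩
    suc (suc (length b + length b))          ≡⟨ cong suc (+-suc (length b) _) ⟨
    suc (length b + suc (length b))          ∎

  length-path : ∀ b → length (path b) ≡ suc (length b) + suc (length b)
  length-path b = trans (length-++ (replicate (suc (downs b)) U))
    (trans (cong (_+ suc (length (expand b))) (length-replicate (suc (downs b)))) (downs+length-expand (D ∷ b)))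

  contract-valid : ∀ h t → dyckFrom h t ≡ true → avoidsDUU (D ∷ t) ≡ true →
                   expand (contract t) ≡ t × downs (contract t) ≡ h
  contract-valid zero    []              _  _ = refl , refl
  contract-valid (suc h) []              () _
  contract-valid zero    (D ∷ t)         () _
  contract-valid (suc h) (D ∷ t)         d  a with contract-valid h t d a
  ... | t≡ , h≡ = cong (D ∷_) t≡ , cong suc h≡
  contract-valid h       (U ∷ [])        d  _ with () ← trans (sym (dyckFrom-U h [])) d
  contract-valid h       (U ∷ U ∷ t)     _  ()
  contract-valid h       (U ∷ D ∷ t)     d  a with contract-valid h t (trans (sym (dyckFrom-U h (D ∷ t))) d) a
  ... | t≡ , h≡ = cong (λ t′ → U ∷ D ∷ t′) t≡ , h≡

  ascent-code : ∀ c s w → dyckFrom c (s ∷ w) ≡ true → avoidsDUU (s ∷ w) ≡ true →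
                path (code (s ∷ w)) ≡ replicate c U ++ s ∷ w
  ascent-code c U []        d _ with () ← trans (sym (dyckFrom-U c [])) d
  ascent-code c U (s ∷ w)   d a = trans (ascent-code (suc c) s w (trans (sym (dyckFrom-U c _)) d) a) (snoc c)
    where
    snoc : ∀ c → replicate (suc c) U ++ s ∷ w ≡ replicate c U ++ U ∷ s ∷ w
    snoc zero    = refl
    snoc (suc c) = cong (U ∷_) (snoc c)
  ascent-code zero    D w () a
  ascent-code (suc c) D w d a with contract-valid c w d a
  ... | w≡ , c≡ = cong₂ (λ h t → replicate (suc h) U ++ D ∷ t) c≡ w≡

  path-code : ∀ w n → good w ≡ true → length w ≡ suc n → path (code w) ≡ w
  path-code (s ∷ w) n g _ with isDyck (s ∷ w) in d
  ... | true = ascent-code 0 s w d g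

  length-code : ∀ w m → good w ≡ true → length w ≡ suc m + suc m → length (code w) ≡ m
  length-code w m g |w| = suc-injective (double-injective _ _ (begin
    suc (length (code w)) + suc (length (code w))  ≡⟨ length-path (code w) ⟨
    length (path (code w))                         ≡⟨ cong length (path-code w _ g |w|) ⟩
    length w                                       ≡⟨ |w| ⟩
    suc m + suc m                                  ∎))
    where
    double-injective : ∀ m n → m + m ≡ n + n → m ≡ n
    double-injective zero    zero    _ = refl
    double-injective (suc m) (suc n) e = cong suc (double-injective m n
      (suc-injective (trans (sym (+-suc m m)) (trans (suc-injective e) (+-suc n n)))))

module Enumeration where

  open FiniteSums
  open Words
  open Paths
  open import Data.Bool using (true; false; if_then_else_)
  open import Data.Empty using (⊥-elim)
  open import Data.List using (List; filter; length; cartesianProduct)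
  open import Data.Nat using (ℕ; suc; _+_)
  open import Data.Product using (proj₁; proj₂)
  open import Relation.Nullary using (yes; no; does)
  open ≡-Reasoning

  ∑-fibre : ∀ m w (g : List Step → ℕ) → length w ≡ suc m + suc m →
            ∑[ b ∈ words m ] (if does (w ≟ʷ path b) then g w else 0) ≡ (if good w then g w else 0)
  ∑-fibre m w g |w| with good w in good-w
  ... | true = trans (∑-cong (words m) same-test) (∑-words-select m (code w) (λ _ → g w) (length-code w m good-w |w|))
    where
    same-test : ∀ b → (if does (w ≟ʷ path b) then g w else 0) ≡ (if does (b ≟ʷ code w) then g w else 0)
    same-test b with w ≟ʷ path b | b ≟ʷ code w
    ... | yes _    | yes _    = refl
    ... | no  _    | no  _    = refl
    ... | yes w≡pb | no  b≢cw = ⊥-elim (b≢cw (trans (sym (code-path b)) (cong code (sym w≡pb))))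
    ... | no  w≢pb | yes b≡cw = ⊥-elim (w≢pb (trans (sym (path-code w _ good-w |w|)) (cong path (sym b≡cw))))
  ... | false = trans (∑-cong (words m) no-match) (∑-zero (words m))
    where
    no-match : ∀ b → (if does (w ≟ʷ path b) then g w else 0) ≡ 0
    no-match b with w ≟ʷ path b
    ... | no _     = refl
    ... | yes refl with () ← trans (sym good-w) (good-path b)

  ∑-good : ∀ m (g : List Step → ℕ) →
           ∑[ w ∈ words (suc m + suc m) ] (if good w then g w else 0) ≡ ∑[ b ∈ words m ] g (path b)
  ∑-good m g = begin
    ∑[ w ∈ words L ] (if good w then g w else 0)
      ≡⟨ ∑-words-cong L (λ w |w| → sym (∑-fibre m w g |w|)) ⟩
    ∑[ w ∈ words L ] ∑[ b ∈ words m ] (if does (w ≟ʷ path b) then g w else 0)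
      ≡⟨ ∑-swap (words L) (words m) _ ⟩
    ∑[ b ∈ words m ] ∑[ w ∈ words L ] (if does (w ≟ʷ path b) then g w else 0)
      ≡⟨ ∑-words-cong m (λ b |b| →
           ∑-words-select L (path b) g (trans (length-path b) (cong (λ k → suc k + suc k) |b|))) ⟩
    ∑[ b ∈ words m ] g (path b)
      ∎
    where L = suc m + suc m

  ∑-Fset : ∀ m (g : List Step → ℕ) → ∑ (Fset (suc m)) g ≡ ∑[ b ∈ words m ] g (path b)
  ∑-Fset m g = trans (∑-filter good _ (words (suc m + suc m)) g) (∑-good m g)

  countPairs-path : ∀ p m → countPairs p (suc m) ≡
                    ∑[ b ∈ words m ] ∑[ b′ ∈ words m ] (if p (path b) (path b′) then 1 else 0)
  countPairs-path p m = begin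
    countPairs p (suc m)
      ≡⟨ trans (length≡∑ (filter _ (cartesianProduct F F)))
           (∑-filter (λ PQ → p (proj₁ PQ) (proj₂ PQ)) _ (cartesianProduct F F) _) ⟩
    ∑[ PQ ∈ cartesianProduct F F ] (if p (proj₁ PQ) (proj₂ PQ) then 1 else 0)
      ≡⟨ ∑-cartesianProduct F F _ ⟩
    ∑[ P ∈ F ] ∑[ Q ∈ F ] (if p P Q then 1 else 0)
      ≡⟨ ∑-Fset m _ ⟩
    ∑[ b ∈ words m ] ∑[ Q ∈ F ] (if p (path b) Q then 1 else 0)
      ≡⟨ ∑-cong (words m) (λ b → ∑-Fset m _) ⟩
    ∑[ b ∈ words m ] ∑[ b′ ∈ words m ] (if p (path b) (path b′) then 1 else 0)
      ∎
    where
    F = Fset (suc m)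

module StanleyOrder where

  open Paths
  open import Data.Bool using (Bool; true; false; _∧_; T)
  open import Data.Bool.ListAction using (and)
  open import Data.List using (List; []; _∷_; _++_; replicate; length; map; drop; zipWith)
  open import Data.List.Relation.Unary.All as All using (All; []; _∷_)
  open import Data.Nat using (ℕ; zero; suc; _+_; _∸_; _≤_; _<_; _≤ᵇ_; z≤n; s≤s; _≤?_)
  open import Data.Nat.Properties
    using (≤-refl; ≤-trans; ≤-reflexive; n≤1+n; m≤m+n; m∸n≤m; +-suc; +-identityʳ; <⇒≱; suc-injective; ≤ᵇ⇒≤)
  open import Data.Unit using (tt)
  open ≡-Reasoning
  open import Relation.Nullary.Decidable using (dec-true; dec-false)

  upsBeforeDowns : ℕ → List Step → List ℕ
  upsBeforeDowns u []      = []
  upsBeforeDowns u (U ∷ w) = upsBeforeDowns (suc u) w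
  upsBeforeDowns u (D ∷ w) = u ∷ upsBeforeDowns u w

  zipLeq : List ℕ → List ℕ → Bool
  zipLeq xs ys = and (zipWith _≤ᵇ_ xs ys)

  ≤ᵇ-true : ∀ {m n} → m ≤ n → (m ≤ᵇ n) ≡ true
  ≤ᵇ-true {m} {n} = dec-true (m ≤? n)

  ≤ᵇ-sound : ∀ {m n} → (m ≤ᵇ n) ≡ true → m ≤ n
  ≤ᵇ-sound {m} {n} e = ≤ᵇ⇒≤ m n (subst T (sym e) tt)

  ≤ᵇ-false : ∀ {m n} → n < m → (m ≤ᵇ n) ≡ false
  ≤ᵇ-false {m} {n} n<m = dec-false (m ≤? n) (<⇒≱ n<m)

  gap-≤ : ∀ h o → h ≤ h + o + o
  gap-≤ h o = ≤-trans (m≤m+n h o) (m≤m+n (h + o) o)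

  gap-suc : ∀ h o → h + suc o + suc o ≡ suc (suc (h + o + o))
  gap-suc h o = trans (+-suc (h + suc o) o) (cong (λ k → suc (k + o)) (+-suc h o))

  +-identityʳ-twice : ∀ h → h + 0 + 0 ≡ h
  +-identityʳ-twice h = trans (+-identityʳ (h + 0)) (+-identityʳ h)

  upsBeforeDowns-≥ : ∀ u w → All (u ≤_) (upsBeforeDowns u w)
  upsBeforeDowns-≥ u []      = []
  upsBeforeDowns-≥ u (U ∷ w) = All.map (≤-trans (n≤1+n u)) (upsBeforeDowns-≥ (suc u) w)
  upsBeforeDowns-≥ u (D ∷ w) = ≤-refl ∷ upsBeforeDowns-≥ u w

  zipLeq-[] : ∀ xs → zipLeq xs [] ≡ true
  zipLeq-[] []       = refl
  zipLeq-[] (x ∷ xs) = refl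

  zipLeq-skip : ∀ {u} o xs ys → All (u ≤_) ys → zipLeq (u ∷ xs) (drop o ys) ≡ zipLeq xs (drop (suc o) ys)
  zipLeq-skip zero    xs []       _          = sym (zipLeq-[] xs)
  zipLeq-skip (suc o) xs []       _          = sym (zipLeq-[] xs)
  zipLeq-skip zero    xs (y ∷ ys) (u≤y ∷ _)  rewrite ≤ᵇ-true u≤y = refl
  zipLeq-skip (suc o) xs (y ∷ ys) (_ ∷ u≤ys) = zipLeq-skip o xs ys u≤ys

  zipLeq-blocked : ∀ h v y ys P → y < v → dyckFrom (suc h) P ≡ true →
                   zipLeq (upsBeforeDowns v P) (y ∷ ys) ≡ false
  zipLeq-blocked h v y ys (U ∷ P) y<v d = zipLeq-blocked (suc h) (suc v) y ys P (≤-trans y<v (n≤1+n v)) d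
  zipLeq-blocked h v y ys (D ∷ P) y<v d rewrite ≤ᵇ-false y<v = refl

  -- P ≤ Q iff before its j-th D step P has made at most as many U steps as Q before its j-th D step.
  -- Invariant: Q is o U steps ahead of P, so the next D of P is compared with the (o+1)-th next D of Q;
  -- the skipped D's of Q come after at least u U steps, so they cannot violate the comparison.
  stanley-via-descents : ∀ P Q h o u → dyckFrom h P ≡ true → length P ≡ length Q →
    pointwiseLeq (heightsFrom h P) (heightsFrom (h + o + o) Q) ≡
    zipLeq (upsBeforeDowns u P) (drop o (upsBeforeDowns (u + o) Q))
  stanley-via-descents []      []      h       o       u d l = refl
  stanley-via-descents (U ∷ P) (U ∷ Q) h       o       u d l
    rewrite ≤ᵇ-true (s≤s (gap-≤ h o)) =
    stanley-via-descents P Q (suc h) o (suc u) (trans (sym (dyckFrom-U h P)) d) (suc-injective l)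
  stanley-via-descents (D ∷ P) (D ∷ Q) (suc h) o       u d l
    rewrite ≤ᵇ-true (gap-≤ h o) =
    trans (stanley-via-descents P Q h o u d (suc-injective l))
          (sym (zipLeq-skip o _ _ (All.map (≤-trans (m≤m+n u o)) (upsBeforeDowns-≥ (u + o) (D ∷ Q)))))
  stanley-via-descents (U ∷ P) (D ∷ Q) h       zero    u d l
    rewrite ≤ᵇ-false {suc h} {h + 0 + 0 ∸ 1} (s≤s (≤-trans (m∸n≤m _ 1) (≤-reflexive (+-identityʳ-twice h)))) =
    sym (zipLeq-blocked h (suc u) (u + 0) _ P (s≤s (≤-reflexive (+-identityʳ u))) (trans (sym (dyckFrom-U h P)) d))
  stanley-via-descents (U ∷ P) (D ∷ Q) h       (suc o) u d l
    rewrite gap-suc h o | ≤ᵇ-true (s≤s (gap-≤ h o)) | +-suc u o =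
    stanley-via-descents P Q (suc h) o (suc u) (trans (sym (dyckFrom-U h P)) d) (suc-injective l)
  stanley-via-descents (D ∷ P) (U ∷ Q) (suc h) o       u d l
    rewrite ≤ᵇ-true (≤-trans (gap-≤ h o) (≤-trans (n≤1+n _) (n≤1+n _))) = begin
    pointwiseLeq (heightsFrom h P) (heightsFrom (suc (suc (h + o + o))) Q)
      ≡⟨ cong (λ k → pointwiseLeq (heightsFrom h P) (heightsFrom k Q)) (gap-suc h o) ⟨
    pointwiseLeq (heightsFrom h P) (heightsFrom (h + suc o + suc o) Q)
      ≡⟨ stanley-via-descents P Q h (suc o) u d (suc-injective l) ⟩
    zipLeq (upsBeforeDowns u P) (drop (suc o) (upsBeforeDowns (u + suc o) Q))
      ≡⟨ cong (λ k → zipLeq (upsBeforeDowns u P) (drop (suc o) (upsBeforeDowns k Q))) (+-suc u o) ⟩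
    zipLeq (upsBeforeDowns u P) (drop (suc o) (upsBeforeDowns (suc (u + o)) Q))
      ≡⟨ zipLeq-skip o _ _ (All.map (≤-trans (≤-trans (m≤m+n u o) (n≤1+n _))) (upsBeforeDowns-≥ _ Q)) ⟨
    zipLeq (u ∷ upsBeforeDowns u P) (drop o (upsBeforeDowns (suc (u + o)) Q))
      ∎
  stanley-via-descents (D ∷ P) (D ∷ Q) zero    o       u () l
  stanley-via-descents (D ∷ P) (U ∷ Q) zero    o       u () l

  -- The heights of path b at the ends of its blocks are the numbers of D's in the suffixes of b.
  _≼_ : List Step → List Step → Bool
  []      ≼ []        = true
  (x ∷ b) ≼ (x′ ∷ b′) = (downs (x ∷ b) ≤ᵇ downs (x′ ∷ b′)) ∧ (b ≼ b′)
  _       ≼ _         = false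

  upsBeforeDowns-suc : ∀ u w → upsBeforeDowns (suc u) w ≡ map suc (upsBeforeDowns u w)
  upsBeforeDowns-suc u []      = refl
  upsBeforeDowns-suc u (U ∷ w) = upsBeforeDowns-suc (suc u) w
  upsBeforeDowns-suc u (D ∷ w) = cong (suc u ∷_) (upsBeforeDowns-suc u w)

  upsBeforeDowns-ascent : ∀ k u w → upsBeforeDowns u (replicate k U ++ w) ≡ upsBeforeDowns (k + u) w
  upsBeforeDowns-ascent zero    u w = refl
  upsBeforeDowns-ascent (suc k) u w =
    trans (upsBeforeDowns-ascent k (suc u) w) (cong (λ v → upsBeforeDowns v w) (+-suc k u))

  descentProfile : List Step → List ℕ
  descentProfile b = upsBeforeDowns (suc (downs b)) (D ∷ expand b)

  upsBeforeDowns-path : ∀ b → upsBeforeDowns 0 (path b) ≡ descentProfile b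
  upsBeforeDowns-path b = trans (upsBeforeDowns-ascent (suc (downs b)) 0 _)
    (cong (λ v → upsBeforeDowns v (D ∷ expand b)) (+-identityʳ (suc (downs b))))

  descentProfile-∷ : ∀ x b → descentProfile (x ∷ b) ≡ suc (downs (x ∷ b)) ∷ map suc (descentProfile b)
  descentProfile-∷ U b = cong (suc (downs b) ∷_) (upsBeforeDowns-suc (suc (downs b)) (D ∷ expand b))
  descentProfile-∷ D b = cong (suc (suc (downs b)) ∷_) (upsBeforeDowns-suc (suc (downs b)) (D ∷ expand b))

  ≤ᵇ-suc : ∀ m n → (suc m ≤ᵇ suc n) ≡ (m ≤ᵇ n)
  ≤ᵇ-suc zero    n = refl
  ≤ᵇ-suc (suc m) n = refl

  zipLeq-suc : ∀ xs ys → zipLeq (map suc xs) (map suc ys) ≡ zipLeq xs ys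
  zipLeq-suc []       ys       = refl
  zipLeq-suc (x ∷ xs) []       = refl
  zipLeq-suc (x ∷ xs) (y ∷ ys) = cong₂ _∧_ (≤ᵇ-suc x y) (zipLeq-suc xs ys)

  zipLeq-descentProfile : ∀ b b′ → length b ≡ length b′ → zipLeq (descentProfile b) (descentProfile b′) ≡ b ≼ b′
  zipLeq-descentProfile []      []        _ = refl
  zipLeq-descentProfile (x ∷ b) (x′ ∷ b′) l = begin
    zipLeq (descentProfile (x ∷ b)) (descentProfile (x′ ∷ b′))
      ≡⟨ cong₂ zipLeq (descentProfile-∷ x b) (descentProfile-∷ x′ b′) ⟩
    (suc z ≤ᵇ suc z′) ∧ zipLeq (map suc (descentProfile b)) (map suc (descentProfile b′))
      ≡⟨ cong₂ _∧_ (≤ᵇ-suc z z′) (zipLeq-suc (descentProfile b) (descentProfile b′)) ⟩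
    (z ≤ᵇ z′) ∧ zipLeq (descentProfile b) (descentProfile b′)
      ≡⟨ cong ((z ≤ᵇ z′) ∧_) (zipLeq-descentProfile b b′ (suc-injective l)) ⟩
    (z ≤ᵇ z′) ∧ (b ≼ b′)
      ∎
    where
    z  = downs (x ∷ b)
    z′ = downs (x′ ∷ b′)

  stanleyLeq-path : ∀ b b′ → length b ≡ length b′ → stanleyLeq (path b) (path b′) ≡ b ≼ b′
  stanleyLeq-path b b′ l = begin
    stanleyLeq (path b) (path b′)
      ≡⟨ stanley-via-descents (path b) (path b′) 0 0 0 (isDyck-path b)
           (trans (length-path b) (trans (cong (λ n → suc n + suc n) l) (sym (length-path b′)))) ⟩
    zipLeq (upsBeforeDowns 0 (path b)) (upsBeforeDowns 0 (path b′))
      ≡⟨ cong₂ zipLeq (upsBeforeDowns-path b) (upsBeforeDowns-path b′) ⟩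
    zipLeq (descentProfile b) (descentProfile b′)
      ≡⟨ zipLeq-descentProfile b b′ l ⟩
    b ≼ b′
      ∎

  firstAscent-path : ∀ b → firstAscent (path b) ≡ suc (downs b)
  firstAscent-path b = ascent (suc (downs b))
    where
    ascent : ∀ k → firstAscent (replicate k U ++ D ∷ expand b) ≡ k
    ascent zero    = refl
    ascent (suc k) = cong suc (ascent k)

  ≼⇒downs≤ : ∀ b b′ → b ≼ b′ ≡ true → downs b ≤ downs b′
  ≼⇒downs≤ []      []        _ = z≤n
  ≼⇒downs≤ (x ∷ b) (x′ ∷ b′) p = ≤ᵇ-sound (∧-trueˡ p)
    where
    ∧-trueˡ : ∀ {a c} → a ∧ c ≡ true → a ≡ true
    ∧-trueˡ {true} _ = refl

module Counting where

  open FiniteSums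
  open Words
  open Paths
  open StanleyOrder
  open Enumeration
  open import Data.Bool using (true; false; _∧_; if_then_else_)
  open import Data.Bool.Properties using (∧-zeroʳ; ∧-identityʳ)
  open import Data.List using (List; _∷_; length)
  open import Data.Nat using (ℕ; zero; suc; _+_; _*_; _∸_; _≤_; _≡ᵇ_; _≤ᵇ_; z≤n; s≤s)
  open import Data.Nat.Properties using (≤-trans; n≤1+n; +-∸-assoc; m+[n∸m]≡n)
  open import Data.Nat.Tactic.RingSolver using (solve-∀)
  open import Function using (_∘_)
  open ≡-Reasoning

  previous : {A : Set} → A → (ℕ → A) → ℕ → A
  previous z f zero    = z
  previous z f (suc k) = f k

  -- downs b′ ∸ downs b is the difference of the first ascents of path b′ and path b.
  weight : (ℕ → ℕ) → List Step → List Step → ℕ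
  weight w b b′ = if b ≼ b′ then w (downs b′ ∸ downs b) else 0

  weightedPairs : ℕ → (ℕ → ℕ) → ℕ
  weightedPairs m w = ∑[ b ∈ words m ] ∑[ b′ ∈ words m ] weight w b b′

  -- Prefixing U to b and D to b′ raises the first-ascent difference by one; prefixing D to b and U to b′
  -- lowers it by one, and the result is comparable only if the difference was positive.
  shiftFor : Step → Step → (ℕ → ℕ) → ℕ → ℕ
  shiftFor U D w = w ∘ suc
  shiftFor D U w = previous 0 w
  shiftFor _ _ w = w

  weight-∷ : ∀ w x x′ b b′ → weight w (x ∷ b) (x′ ∷ b′) ≡ weight (shiftFor x x′ w) b b′
  weight-∷ w x x′ b b′ with b ≼ b′ in b≼b′
  ... | false rewrite ∧-zeroʳ (downs (x ∷ b) ≤ᵇ downs (x′ ∷ b′)) = refl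
  ... | true  rewrite ∧-identityʳ (downs (x ∷ b) ≤ᵇ downs (x′ ∷ b′)) = step x x′ (≼⇒downs≤ b b′ b≼b′)
    where
    step : ∀ x x′ → downs b ≤ downs b′ →
           (if downs (x ∷ b) ≤ᵇ downs (x′ ∷ b′) then w (downs (x′ ∷ b′) ∸ downs (x ∷ b)) else 0) ≡
           shiftFor x x′ w (downs b′ ∸ downs b)
    step U U z≤z′ rewrite ≤ᵇ-true z≤z′ = refl
    step D D z≤z′ rewrite ≤ᵇ-suc (downs b) (downs b′) | ≤ᵇ-true z≤z′ = refl
    step U D z≤z′ rewrite ≤ᵇ-true (≤-trans z≤z′ (n≤1+n _)) = cong w (+-∸-assoc 1 z≤z′)
    step D U z≤z′ = descend z≤z′
      where
      descend : ∀ {z z′} → z ≤ z′ → (if suc z ≤ᵇ z′ then w (z′ ∸ suc z) else 0) ≡ previous 0 w (z′ ∸ z)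
      descend {z′ = zero}  z≤n = refl
      descend {z′ = suc _} z≤n = refl
      descend (s≤s z≤z′) = descend z≤z′

  weightedPairs-cong : ∀ m {w w′} → (∀ d → w d ≡ w′ d) → weightedPairs m w ≡ weightedPairs m w′
  weightedPairs-cong m w≗w′ = ∑-cong (words m) λ b → ∑-cong (words m) λ b′ →
    cong (λ v → if b ≼ b′ then v else 0) (w≗w′ _)

  weightedPairs-+ : ∀ m w w′ → weightedPairs m (λ d → w d + w′ d) ≡ weightedPairs m w + weightedPairs m w′
  weightedPairs-+ m w w′ = trans (∑-cong (words m) λ b → trans (∑-cong (words m) (weight-+ b)) (∑-+ (words m) _ _))
    (∑-+ (words m) _ _)
    where
    weight-+ : ∀ b b′ → weight (λ d → w d + w′ d) b b′ ≡ weight w b b′ + weight w′ b b′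
    weight-+ b b′ with b ≼ b′
    ... | true  = refl
    ... | false = refl

  weightedPairs-zero : ∀ m → weightedPairs m (λ _ → 0) ≡ 0
  weightedPairs-zero m = trans (∑-cong (words m) λ b → trans (∑-cong (words m) (no-weight b)) (∑-zero (words m)))
    (∑-zero (words m))
    where
    no-weight : ∀ b b′ → weight (λ _ → 0) b b′ ≡ 0
    no-weight b b′ with b ≼ b′
    ... | true  = refl
    ... | false = refl

  weightedPairs-suc : ∀ m w → weightedPairs (suc m) w ≡
    (weightedPairs m w + weightedPairs m (w ∘ suc)) + (weightedPairs m (previous 0 w) + weightedPairs m w)
  weightedPairs-suc m w = trans (∑-words-split m _) (cong₂ _+_ (rows U) (rows D))
    where
    rows : ∀ x → ∑[ b ∈ words m ] ∑[ b′ ∈ words (suc m) ] weight w (x ∷ b) b′ ≡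
                 weightedPairs m (shiftFor x U w) + weightedPairs m (shiftFor x D w)
    rows x = trans (∑-cong (words m) λ b → trans (∑-words-split m _)
                     (cong₂ _+_ (∑-cong (words m) (weight-∷ w x U b)) (∑-cong (words m) (weight-∷ w x D b))))
                   (∑-+ (words m) _ _)

  δ : ℕ → ℕ → ℕ
  δ k d = if d ≡ᵇ k then 1 else 0

  iNK≡weightedPairs : ∀ m k → iNK (suc m) k ≡ weightedPairs m (δ k)
  iNK≡weightedPairs m k = trans (countPairs-path _ m)
    (∑-words-cong m λ b |b| → ∑-words-cong m λ b′ |b′| → pair b b′ (trans |b| (sym |b′|)))
    where
    ≡ᵇ-+ : ∀ z a → (z + a ≡ᵇ z + k) ≡ (a ≡ᵇ k)
    ≡ᵇ-+ zero    a = refl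
    ≡ᵇ-+ (suc z) a = ≡ᵇ-+ z a
    offset : ∀ b b′ → (if (b ≼ b′) ∧ (downs b′ ≡ᵇ downs b + k) then 1 else 0) ≡ weight (δ k) b b′
    offset b b′ with b ≼ b′ in b≼b′
    ... | false = refl
    ... | true  = cong (λ c → if c then 1 else 0)
                    (trans (cong (_≡ᵇ downs b + k) (sym (m+[n∸m]≡n (≼⇒downs≤ b b′ b≼b′)))) (≡ᵇ-+ (downs b) _))
    pair : ∀ b b′ → length b ≡ length b′ →
           (if stanleyLeq (path b) (path b′) ∧ (firstAscent (path b′) ≡ᵇ firstAscent (path b) + k) then 1 else 0) ≡
           weight (δ k) b b′
    pair b b′ l = trans (cong₂ (λ s e → if s ∧ e then 1 else 0) (stanleyLeq-path b b′ l)
                    (cong₂ (λ a a′ → a′ ≡ᵇ a + k) (firstAscent-path b) (firstAscent-path b′))) (offset b b′)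

  intervals≡weightedPairs : ∀ m → intervals (suc m) ≡ weightedPairs m (λ _ → 1)
  intervals≡weightedPairs m = trans (countPairs-path _ m)
    (∑-words-cong m λ b |b| → ∑-words-cong m λ b′ |b′| →
      cong (λ s → if s then 1 else 0) (stanleyLeq-path b b′ (trans |b| (sym |b′|))))

  iNK-rec : ∀ m k → iNK (suc (suc m)) k ≡
            iNK (suc m) k + iNK (suc m) k + iNK (suc m) (suc k) + previous 0 (iNK (suc m)) k
  iNK-rec m k = begin
    iNK (suc (suc m)) k
      ≡⟨ trans (iNK≡weightedPairs (suc m) k) (weightedPairs-suc m (δ k)) ⟩
    (weightedPairs m (δ k) + weightedPairs m (δ k ∘ suc)) + (weightedPairs m (previous 0 (δ k)) + weightedPairs m (δ k))
      ≡⟨ cong₂ (λ a b → (a + b) + (weightedPairs m (previous 0 (δ k)) + a)) (sym (iNK≡weightedPairs m k)) (one-less k) ⟩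
    (iNK (suc m) k + previous 0 (iNK (suc m)) k) + (weightedPairs m (previous 0 (δ k)) + iNK (suc m) k)
      ≡⟨ cong (λ a → (iNK (suc m) k + previous 0 (iNK (suc m)) k) + (a + iNK (suc m) k))
           (trans (weightedPairs-cong m previous-δ) (sym (iNK≡weightedPairs m (suc k)))) ⟩
    (iNK (suc m) k + previous 0 (iNK (suc m)) k) + (iNK (suc m) (suc k) + iNK (suc m) k)
      ≡⟨ regroup (iNK (suc m) k) (previous 0 (iNK (suc m)) k) (iNK (suc m) (suc k)) ⟩
    iNK (suc m) k + iNK (suc m) k + iNK (suc m) (suc k) + previous 0 (iNK (suc m)) k
      ∎
    where
    one-less : ∀ k → weightedPairs m (δ k ∘ suc) ≡ previous 0 (iNK (suc m)) k
    one-less zero    = weightedPairs-zero m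
    one-less (suc k) = sym (iNK≡weightedPairs m k)
    previous-δ : ∀ d → previous 0 (δ k) d ≡ δ (suc k) d
    previous-δ zero    = refl
    previous-δ (suc d) = refl
    regroup : ∀ a b c → (a + b) + (c + a) ≡ a + a + c + b
    regroup = solve-∀

  intervals-rec : ∀ m → intervals (suc (suc m)) + iNK (suc m) 0 ≡ 4 * intervals (suc m)
  intervals-rec m = begin
    intervals (suc (suc m)) + iNK (suc m) 0
      ≡⟨ cong₂ _+_ (trans (intervals≡weightedPairs (suc m)) (weightedPairs-suc m _)) (iNK≡weightedPairs m 0) ⟩
    (T + T) + (weightedPairs m (previous 0 (λ _ → 1)) + T) + weightedPairs m (δ 0)
      ≡⟨ regroup T (weightedPairs m (previous 0 (λ _ → 1))) (weightedPairs m (δ 0)) ⟩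
    3 * T + (weightedPairs m (previous 0 (λ _ → 1)) + weightedPairs m (δ 0))
      ≡⟨ cong (3 * T +_) (trans (sym (weightedPairs-+ m (previous 0 (λ _ → 1)) (δ 0)))
                               (weightedPairs-cong m previous+δ)) ⟩
    3 * T + T
      ≡⟨ regroup-4 T ⟩
    4 * T
      ≡⟨ cong (4 *_) (intervals≡weightedPairs m) ⟨
    4 * intervals (suc m)
      ∎
    where
    T = weightedPairs m (λ _ → 1)
    previous+δ : ∀ d → previous 0 (λ _ → 1) d + δ 0 d ≡ 1
    previous+δ zero    = refl
    previous+δ (suc d) = refl
    regroup : ∀ t a b → (t + t) + (a + t) + b ≡ 3 * t + (a + b)
    regroup = solve-∀
    regroup-4 : ∀ t → 3 * t + t ≡ 4 * t
    regroup-4 = solve-∀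

module Ballot where

  open Counting using (previous; iNK-rec; intervals-rec)
  open import Data.Nat using (ℕ; zero; suc; _+_; _*_; _∸_; _≤_; pred; s≤s; z≤n)
  open import Data.Nat.Combinatorics using (_C_; nCk+nC[k+1]≡[n+1]C[k+1]; nCk≡nC[n∸k]; k>n⇒nCk≡0)
  open import Data.Nat.Properties
    using (+-suc; +-identityʳ; +-cancelʳ-≡; m≤m+n; m≤n⇒m≤1+n; +-∸-assoc; m+n∸n≡m; m≤n+m)
  open import Data.Nat.Tactic.RingSolver using (solve-∀)
  open ≡-Reasoning

  ballot : ℕ → ℕ → ℕ
  ballot m j = suc (m + m) C suc (m + j)

  pascal² : ∀ n k → suc (suc n) C suc (suc k) ≡ n C k + n C suc k + (n C suc k + n C suc (suc k))
  pascal² n k = sym (trans (cong₂ _+_ (nCk+nC[k+1]≡[n+1]C[k+1] n k) (nCk+nC[k+1]≡[n+1]C[k+1] n (suc k)))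
                           (nCk+nC[k+1]≡[n+1]C[k+1] (suc n) (suc k)))

  ballot-suc : ∀ m j → ballot (suc m) j ≡ ballot m (pred j) + ballot m j + (ballot m j + ballot m (suc j))
  ballot-suc m j = begin
    suc (suc m + suc m) C suc (suc m + j)
      ≡⟨ cong (λ n → suc n C suc (suc (m + j))) (+-suc (suc m) m) ⟩
    suc (suc (suc (m + m))) C suc (suc (m + j))
      ≡⟨ pascal² (suc (m + m)) (m + j) ⟩
    n C (m + j) + n C suc (m + j) + (n C suc (m + j) + n C suc (suc (m + j)))
      ≡⟨ cong₂ (λ a b → a + ballot m j + (ballot m j + n C suc b)) (below j) (sym (+-suc m j)) ⟩
    ballot m (pred j) + ballot m j + (ballot m j + ballot m (suc j))
      ∎
    where
    n = suc (m + m)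
    below : ∀ j → n C (m + j) ≡ ballot m (pred j)
    below zero    = begin
      n C (m + 0)      ≡⟨ cong (n C_) (+-identityʳ m) ⟩
      n C m            ≡⟨ nCk≡nC[n∸k] (m≤n⇒m≤1+n (m≤m+n m m)) ⟩
      n C (n ∸ m)      ≡⟨ cong (n C_) (trans (+-∸-assoc 1 (m≤n+m m m)) (cong suc (m+n∸n≡m m m))) ⟩
      n C suc m        ≡⟨ cong (λ k → n C suc k) (+-identityʳ m) ⟨
      n C suc (m + 0)  ∎
    below (suc j) = cong (n C_) (+-suc m j)

  iNK-ballot : ∀ m k → iNK (suc m) k + ballot m (suc k) ≡ ballot m k
  iNK-ballot zero    zero    = refl
  iNK-ballot zero    (suc k) =
    trans (k>n⇒nCk≡0 {1} {3 + k} (s≤s (s≤s z≤n))) (sym (k>n⇒nCk≡0 {1} {2 + k} (s≤s (s≤s z≤n))))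
  iNK-ballot (suc m) k = begin
    iNK (suc (suc m)) k + ballot (suc m) (suc k)
      ≡⟨ cong₂ _+_ (iNK-rec m k) (ballot-suc m (suc k)) ⟩
    (a k + a k + a (suc k) + previous 0 a k) + (b k + b (suc k) + (b (suc k) + b (suc (suc k))))
      ≡⟨ combine (below k) (iNK-ballot m k) (iNK-ballot m (suc k)) ⟩
    b (pred k) + b k + (b k + b (suc k))
      ≡⟨ ballot-suc m k ⟨
    ballot (suc m) k
      ∎
    where
    a = iNK (suc m)
    b = ballot m
    below : ∀ k → previous 0 a k + b k ≡ b (pred k)
    below zero    = refl
    below (suc k) = iNK-ballot m k
    combine : ∀ {a₋ a₀ a₁ b₋ b₀ b₁ b₂} → a₋ + b₀ ≡ b₋ → a₀ + b₁ ≡ b₀ → a₁ + b₂ ≡ b₁ →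
              (a₀ + a₀ + a₁ + a₋) + (b₀ + b₁ + (b₁ + b₂)) ≡ b₋ + b₀ + (b₀ + b₁)
    combine {a₋} {a₀} {a₁} {b₂ = b₂} refl refl refl = polynomial a₋ a₀ a₁ b₂
      where
      polynomial : ∀ a₋ a₀ a₁ b₂ → (a₀ + a₀ + a₁ + a₋) + (a₀ + (a₁ + b₂) + (a₁ + b₂) + (a₁ + b₂ + b₂)) ≡
                   a₋ + (a₀ + (a₁ + b₂)) + (a₀ + (a₁ + b₂)) + (a₀ + (a₁ + b₂) + (a₁ + b₂))
      polynomial = solve-∀

  intervals-ballot : ∀ m → intervals (suc m) ≡ ballot m 0
  intervals-ballot zero    = refl
  intervals-ballot (suc m) = +-cancelʳ-≡ (iNK (suc m) 0) _ _ (begin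
    intervals (suc (suc m)) + iNK (suc m) 0       ≡⟨ intervals-rec m ⟩
    4 * intervals (suc m)                         ≡⟨ cong (4 *_) (intervals-ballot m) ⟩
    4 * ballot m 0                                ≡⟨ combine (iNK-ballot m 0) ⟩
    ballot m 0 + ballot m 0 + (ballot m 0 + ballot m 1) + iNK (suc m) 0  ≡⟨ cong (_+ iNK (suc m) 0) (ballot-suc m 0) ⟨
    ballot (suc m) 0 + iNK (suc m) 0              ∎)
    where
    combine : ∀ {a₀ b₀ b₁} → a₀ + b₁ ≡ b₀ → 4 * b₀ ≡ b₀ + b₀ + (b₀ + b₁) + a₀
    combine {a₀} {b₁ = b₁} refl = polynomial a₀ b₁
      where
      polynomial : ∀ a₀ b₁ → 4 * (a₀ + b₁) ≡ a₀ + b₁ + (a₀ + b₁) + (a₀ + b₁ + b₁) + a₀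
      polynomial = solve-∀

  intervals-binomial : ∀ n → 1 ≤ n → intervals n ≡ (n + n ∸ 1) C n
  intervals-binomial (suc m) _ = trans (intervals-ballot m) (cong₂ _C_ (sym (+-suc m m)) (cong suc (+-identityʳ m)))

module PowerSeries where

  open import Algebra.Solver.Ring.AlmostCommutativeRing
    using (AlmostCommutativeRing; _-Raw-AlmostCommutative⟶_)
  import Algebra.Construct.Pointwise
  import Algebra.Structures as Structures
  open import Algebra.Structures.Biased using (isCommutativeSemiringˡ; isCommutativeMonoidˡ)
  open import Data.Empty using (⊥-elim)
  open import Data.Integer as ℤ using (ℤ; +_; _+_; _*_; -_; _≟_)
  import Data.Integer.Properties as ℤ
  open import Data.Integer.Tactic.RingSolver using (solve-∀)
  open import Data.List using (foldr; applyUpTo)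
  open import Data.List.Properties using (map-applyUpTo)
  open import Data.Maybe using (Maybe; just; nothing)
  open import Data.Nat as ℕ using (ℕ; zero; suc; _∸_; _≤_; _<_; s≤s; z≤n)
  open import Data.Nat.Induction using (<-rec)
  import Data.Nat.Properties as ℕ
  open import Data.Sum using (inj₁; inj₂)
  open import Function using (_∘_)
  open import Level using (0ℓ)
  open import Relation.Nullary using (yes; no)

  module Pointwise = Algebra.Construct.Pointwise ℕ

  σ : ℕ → (ℕ → ℤ) → ℤ
  σ zero    f = f 0
  σ (suc n) f = f 0 + σ n (f ∘ suc)

  sumTo≡σ : ∀ n f → sumTo n f ≡ σ n f
  sumTo≡σ n f = trans (cong (foldr _+_ (+ 0)) (map-applyUpTo (λ i → i) f (suc n))) (go n f)
    where
    go : ∀ n f → foldr _+_ (+ 0) (applyUpTo f (suc n)) ≡ σ n f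
    go zero    f = ℤ.+-identityʳ (f 0)
    go (suc n) f = cong (λ x → f 0 + x) (go n (f ∘ suc))

  σ-cong : ∀ n {f g} → (∀ i → i ≤ n → f i ≡ g i) → σ n f ≡ σ n g
  σ-cong zero    f≗g = f≗g 0 z≤n
  σ-cong (suc n) f≗g = cong₂ _+_ (f≗g 0 z≤n) (σ-cong n (λ i i≤n → f≗g (suc i) (s≤s i≤n)))

  σ-zero : ∀ n {f} → (∀ i → i ≤ n → f i ≡ + 0) → σ n f ≡ + 0
  σ-zero n f≗0 = trans (σ-cong n f≗0) (σ-0 n)
    where
    σ-0 : ∀ n → σ n (λ _ → + 0) ≡ + 0
    σ-0 zero    = refl
    σ-0 (suc n) = trans (ℤ.+-identityˡ _) (σ-0 n)

  σ-+ : ∀ n f g → σ n (λ i → f i + g i) ≡ σ n f + σ n g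
  σ-+ zero    f g = refl
  σ-+ (suc n) f g rewrite σ-+ n (f ∘ suc) (g ∘ suc) = swap (f 0) (g 0) _ _
    where
    swap : ∀ a b c d → a + b + (c + d) ≡ a + c + (b + d)
    swap = solve-∀

  σ-*ˡ : ∀ n c f → σ n (λ i → c * f i) ≡ c * σ n f
  σ-*ˡ zero    c f = refl
  σ-*ˡ (suc n) c f rewrite σ-*ˡ n c (f ∘ suc) = sym (ℤ.*-distribˡ-+ c (f 0) _)

  σ-neg : ∀ n f → σ n (λ i → - f i) ≡ - σ n f
  σ-neg zero    f = refl
  σ-neg (suc n) f rewrite σ-neg n (f ∘ suc) = sym (ℤ.neg-distrib-+ (f 0) _)

  σ-last : ∀ n f → σ (suc n) f ≡ σ n f + f (suc n)
  σ-last zero    f = refl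
  σ-last (suc n) f rewrite σ-last n (f ∘ suc) = sym (ℤ.+-assoc (f 0) _ _)

  σ-only-last : ∀ n f → (∀ i → i < n → f i ≡ + 0) → σ n f ≡ f n
  σ-only-last zero    f _      = refl
  σ-only-last (suc n) f before = trans
    (cong₂ _+_ (before 0 (s≤s z≤n)) (σ-only-last n (f ∘ suc) (λ i i<n → before (suc i) (s≤s i<n))))
    (ℤ.+-identityˡ _)

  σ-reverse : ∀ n f → σ n f ≡ σ n (λ i → f (n ∸ i))
  σ-reverse zero    f = refl
  σ-reverse (suc n) f = begin
    f 0 + σ n (f ∘ suc)                   ≡⟨ cong (λ x → f 0 + x) (σ-reverse n (f ∘ suc)) ⟩
    f 0 + σ n (λ i → f (suc (n ∸ i)))     ≡⟨ ℤ.+-comm (f 0) _ ⟩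
    σ n (λ i → f (suc (n ∸ i))) + f 0     ≡⟨ cong (_+ f 0) (σ-cong n (λ i i≤n → cong f (sym (ℕ.+-∸-assoc 1 i≤n)))) ⟩
    σ n (λ i → f (suc n ∸ i)) + f 0       ≡⟨ cong (λ j → σ n (λ i → f (suc n ∸ i)) + f j) (sym (ℕ.n∸n≡0 n)) ⟩
    σ n (λ i → f (suc n ∸ i)) + f (n ∸ n) ≡⟨ sym (σ-last n (λ i → f (suc n ∸ i))) ⟩
    σ (suc n) (λ i → f (suc n ∸ i))       ∎
    where open ≡-Reasoning

  σ-swap : ∀ m n (f : ℕ → ℕ → ℤ) → σ m (λ i → σ n (f i)) ≡ σ n (λ j → σ m (λ i → f i j))
  σ-swap zero    n f = refl
  σ-swap (suc m) n f = begin
    σ n (f 0) + σ m (λ i → σ n (f (suc i)))          ≡⟨ cong (λ x → σ n (f 0) + x) (σ-swap m n (f ∘ suc)) ⟩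
    σ n (f 0) + σ n (λ j → σ m (λ i → f (suc i) j))  ≡⟨ sym (σ-+ n (f 0) _) ⟩
    σ n (λ j → f 0 j + σ m (λ i → f (suc i) j))      ∎
    where open ≡-Reasoning

  PS : Set
  PS = PS1

  _≈_ : PS → PS → Set
  _≈_ = _≈₁_

  infix  4 _≈_
  infixl 6 _⊕_ _⊖_
  infixl 7 _⊗_
  infix  8 ⊖_

  constant : ℤ → PS
  constant c zero    = c
  constant c (suc n) = + 0

  𝟎 𝟏 : PS
  𝟎 _ = + 0
  𝟏 = constant (+ 1)

  X : PS
  X zero    = + 0
  X (suc n) = 𝟏 n

  -- Opaque, so that unification compares series instead of their unfolded integer coefficients.
  opaque
    _⊕_ : PS → PS → PS
    (A ⊕ B) n = A n + B n

    ⊖_ : PS → PS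
    (⊖ A) n = - A n

    _⊗_ : PS → PS → PS
    (A ⊗ B) n = σ n (λ i → A i * B (n ∸ i))

  _⊖_ : PS → PS → PS
  A ⊖ B = A ⊕ ⊖ B

  open Structures _≈_ using (IsCommutativeMonoid)

  opaque
    unfolding _⊕_ ⊖_ _⊗_

    ⊕-coefficient : ∀ A B n → (A ⊕ B) n ≡ A n + B n
    ⊕-coefficient A B n = refl

    ⊖-coefficient : ∀ A B n → (A ⊖ B) n ≡ A n ℤ.- B n
    ⊖-coefficient A B n = refl

    neg-coefficient : ∀ A n → (⊖ A) n ≡ - A n
    neg-coefficient A n = refl

    ⊗-coefficient : ∀ A B n → (A ⊗ B) n ≡ σ n (λ i → A i * B (n ∸ i))
    ⊗-coefficient A B n = refl

    ⊕-isCommutativeMonoid : IsCommutativeMonoid _⊕_ 𝟎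
    ⊕-isCommutativeMonoid = Pointwise.isCommutativeMonoid ℤ.+-0-isCommutativeMonoid

    ⊖-cong : ∀ {A B} → A ≈ B → ⊖ A ≈ ⊖ B
    ⊖-cong A≈B n = cong -_ (A≈B n)

    ⊖-⊕ : ∀ A B → ⊖ A ⊕ ⊖ B ≈ ⊖ (A ⊕ B)
    ⊖-⊕ A B n = sym (ℤ.neg-distrib-+ (A n) (B n))

    ⊗-cong : ∀ {A A′ B B′} → A ≈ A′ → B ≈ B′ → A ⊗ B ≈ A′ ⊗ B′
    ⊗-cong A≈A′ B≈B′ n = σ-cong n (λ i _ → cong₂ _*_ (A≈A′ i) (B≈B′ (n ∸ i)))

    ⊗-comm : ∀ A B → A ⊗ B ≈ B ⊗ A
    ⊗-comm A B n = trans (σ-reverse n _) (σ-cong n λ i i≤n →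
      trans (cong (λ j → A (n ∸ i) * B j) (ℕ.m∸[m∸n]≡n i≤n)) (ℤ.*-comm (A (n ∸ i)) (B i)))

    ⊗-zeroˡ : ∀ A → 𝟎 ⊗ A ≈ 𝟎
    ⊗-zeroˡ A n = σ-zero n (λ _ _ → refl)

    ⊗-identityˡ : ∀ A → 𝟏 ⊗ A ≈ A
    ⊗-identityˡ A zero    = ℤ.*-identityˡ (A 0)
    ⊗-identityˡ A (suc n) = trans (cong₂ _+_ (ℤ.*-identityˡ (A (suc n))) (⊗-zeroˡ A n)) (ℤ.+-identityʳ _)

    ⊗-distribʳ : ∀ C A B → (A ⊕ B) ⊗ C ≈ A ⊗ C ⊕ B ⊗ C
    ⊗-distribʳ C A B n = trans (σ-cong n (λ i _ → ℤ.*-distribʳ-+ (C (n ∸ i)) (A i) (B i))) (σ-+ n _ _)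

    ⊗-assoc : ∀ A B C → (A ⊗ B) ⊗ C ≈ A ⊗ (B ⊗ C)
    ⊗-assoc A B C zero    = ℤ.*-assoc (A 0) (B 0) (C 0)
    ⊗-assoc A B C (suc n) = begin
      A 0 * B 0 * C (suc n) + σ n (λ i → (A 0 * B (suc i) + (A′ ⊗ B) i) * C (n ∸ i))
        ≡⟨ cong (λ x → A 0 * B 0 * C (suc n) + x) (trans (⊗-distribʳ C (λ i → A 0 * B (suc i)) (A′ ⊗ B) n)
             (cong₂ _+_ (trans (σ-cong n (λ i _ → ℤ.*-assoc (A 0) _ _)) (σ-*ˡ n (A 0) _)) (⊗-assoc A′ B C n))) ⟩
      A 0 * B 0 * C (suc n) + (A 0 * (B′ ⊗ C) n + (A′ ⊗ (B ⊗ C)) n)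
        ≡⟨ regroup (A 0) (B 0) (C (suc n)) _ _ ⟩
      A 0 * (B 0 * C (suc n) + (B′ ⊗ C) n) + (A′ ⊗ (B ⊗ C)) n
        ∎
      where
      open ≡-Reasoning
      A′ B′ : PS
      A′ i = A (suc i)
      B′ i = B (suc i)
      regroup : ∀ a b c x y → a * b * c + (a * x + y) ≡ a * (b * c + x) + y
      regroup = solve-∀

    ⊖-⊗ : ∀ A B → (⊖ A) ⊗ B ≈ ⊖ (A ⊗ B)
    ⊖-⊗ A B n = trans (σ-cong n (λ i _ → sym (ℤ.neg-distribˡ-* (A i) _))) (σ-neg n _)

    constant-⊕ : ∀ a b → constant (a + b) ≈ constant a ⊕ constant b
    constant-⊕ a b zero    = refl
    constant-⊕ a b (suc n) = refl

    constant-⊖ : ∀ a → constant (- a) ≈ ⊖ constant a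
    constant-⊖ a zero    = refl
    constant-⊖ a (suc n) = refl

    constant-⊗ : ∀ c A n → (constant c ⊗ A) n ≡ c * A n
    constant-⊗ c A zero    = refl
    constant-⊗ c A (suc n) = trans (cong (λ x → c * A (suc n) + x) (⊗-zeroˡ A n)) (ℤ.+-identityʳ _)

    X⊗-zero : ∀ A → (X ⊗ A) 0 ≡ + 0
    X⊗-zero A = refl

    X⊗-suc : ∀ A n → (X ⊗ A) (suc n) ≡ A n
    X⊗-suc A n = trans (ℤ.+-identityˡ _) (⊗-identityˡ A n)

    ⊗-leading : ∀ A B n → (∀ i → i < n → B i ≡ + 0) → (B ⊗ A) n ≡ B n * A 0
    ⊗-leading A B zero    _     = refl
    ⊗-leading A B (suc n) below = begin
      (B ⊗ A) (suc n)
        ≡⟨ σ-last n _ ⟩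
      σ n (λ i → B i * A (suc n ∸ i)) + B (suc n) * A (n ∸ n)
        ≡⟨ cong₂ _+_ (σ-zero n (λ i i≤n → cong (_* A (suc n ∸ i)) (below i (s≤s i≤n))))
                     (cong (λ k → B (suc n) * A k) (ℕ.n∸n≡0 n)) ⟩
      + 0 + B (suc n) * A 0
        ≡⟨ ℤ.+-identityˡ _ ⟩
      B (suc n) * A 0
        ∎
      where open ≡-Reasoning

  seriesRing : AlmostCommutativeRing 0ℓ 0ℓ
  seriesRing = record
    { Carrier = PS ; _≈_ = _≈_ ; _+_ = _⊕_ ; _*_ = _⊗_ ; -_ = ⊖_ ; 0# = 𝟎 ; 1# = 𝟏
    ; isAlmostCommutativeRing = record
      { isCommutativeSemiring = isCommutativeSemiringˡ record
        { +-isCommutativeMonoid = ⊕-isCommutativeMonoid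
        ; *-isCommutativeMonoid = isCommutativeMonoidˡ record
          { isSemigroup = record
            { isMagma = record { isEquivalence = Pointwise.isEquivalence isEquivalence ; ∙-cong = ⊗-cong }
            ; assoc   = ⊗-assoc
            }
          ; identityˡ = ⊗-identityˡ
          ; comm      = ⊗-comm
          }
        ; distribʳ = ⊗-distribʳ
        ; zeroˡ    = ⊗-zeroˡ
        }
      ; -‿cong       = ⊖-cong
      ; -‿*-distribˡ = ⊖-⊗
      ; -‿+-comm     = ⊖-⊕
      }
    }

  constant-homomorphism : ℤ.+-*-rawRing -Raw-AlmostCommutative⟶ seriesRing
  constant-homomorphism = record
    { ⟦_⟧    = constant
    ; +-homo = constant-⊕
    ; *-homo = λ { a b zero → sym (constant-⊗ a (constant b) 0)
                 ; a b (suc n) → sym (trans (constant-⊗ a (constant b) (suc n)) (ℤ.*-zeroʳ a)) }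
    ; -‿homo = constant-⊖
    ; 0-homo = λ { zero → refl ; (suc n) → refl }
    ; 1-homo = λ _ → refl
    }

  𝟏⊖cX-coefficient : ∀ c n → (𝟏 ⊖ constant c ⊗ X) n ≡ 𝟏 n ℤ.- c * X n
  𝟏⊖cX-coefficient c n = trans (⊖-coefficient _ _ n) (cong (λ x → 𝟏 n ℤ.- x) (constant-⊗ c X n))

  constant-≟ : ∀ a b → Maybe (constant a ≈ constant b)
  constant-≟ a b with a ≟ b
  ... | yes refl = just (λ _ → refl)
  ... | no  _    = nothing

  open import Algebra.Solver.Ring ℤ.+-*-rawRing seriesRing constant-homomorphism constant-≟
    public using (Polynomial; solve; _:=_; con; _:+_; _:*_; _:-_; :-_)

  open AlmostCommutativeRing seriesRing public
    using () renaming (setoid to ≈-setoid; refl to ≈-refl; sym to ≈-sym; trans to ≈-trans;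
                       *-identityʳ to ⊗-identityʳ; zeroʳ to ⊗-zeroʳ)

  ⊕-cong : ∀ {A A′ B B′} → A ≈ A′ → B ≈ B′ → A ⊕ B ≈ A′ ⊕ B′
  ⊕-cong = AlmostCommutativeRing.+-cong seriesRing

  constant-zero : constant (+ 0) ≈ 𝟎
  constant-zero zero    = refl
  constant-zero (suc n) = refl

  ⊗-cancel : ∀ A B → A 0 ≢ + 0 → B ⊗ A ≈ 𝟎 → B ≈ 𝟎
  ⊗-cancel A B A₀≢0 BA≈0 = <-rec (λ n → B n ≡ + 0) step
    where
    step : ∀ n → (∀ {i} → i < n → B i ≡ + 0) → B n ≡ + 0
    step n below with ℤ.i*j≡0⇒i≡0∨j≡0 (B n) (trans (sym (⊗-leading A B n (λ i → below))) (BA≈0 n))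
    ... | inj₁ Bₙ≡0 = Bₙ≡0
    ... | inj₂ A₀≡0 = ⊥-elim (A₀≢0 A₀≡0)

  ⊗-cancelˡ : ∀ A B C → A 0 ≢ + 0 → A ⊗ B ≈ A ⊗ C → B ≈ C
  ⊗-cancelˡ A B C A₀≢0 AB≈AC n =
    ℤ.i-j≡0⇒i≡j (B n) (C n) (trans (sym (⊖-coefficient B C n)) (⊗-cancel A (B ⊖ C) A₀≢0 difference n))
    where
    difference : (B ⊖ C) ⊗ A ≈ 𝟎
    difference = begin
      (B ⊖ C) ⊗ A          ≈⟨ solve 3 (λ a b c → (b :- c) :* a := a :* b :- a :* c) (λ _ → refl) A B C ⟩
      A ⊗ B ⊖ A ⊗ C        ≈⟨ ⊕-cong AB≈AC ≈-refl ⟩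
      A ⊗ C ⊖ A ⊗ C        ≈⟨ solve 1 (λ x → x :- x := con (+ 0)) (λ _ → refl) (A ⊗ C) ⟩
      constant (+ 0)       ≈⟨ constant-zero ⟩
      𝟎                    ∎
      where open import Relation.Binary.Reasoning.Setoid ≈-setoid

  sqrt-unique : ∀ A B → A 0 ≡ + 1 → B 0 ≡ + 1 → A ⊗ A ≈ B ⊗ B → A ≈ B
  sqrt-unique A B A₀ B₀ AA≈BB = ⊗-cancelˡ (A ⊕ B) A B A₀+B₀≢0 (begin
      (A ⊕ B) ⊗ A      ≈⟨ solve 2 (λ a b → (a :+ b) :* a := a :* a :+ a :* b) (λ _ → refl) A B ⟩
      A ⊗ A ⊕ A ⊗ B    ≈⟨ ⊕-cong AA≈BB ≈-refl ⟩
      B ⊗ B ⊕ A ⊗ B    ≈⟨ solve 2 (λ a b → b :* b :+ a :* b := (a :+ b) :* b) (λ _ → refl) A B ⟩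
      (A ⊕ B) ⊗ B      ∎)
    where
    open import Relation.Binary.Reasoning.Setoid ≈-setoid
    A₀+B₀≢0 : (A ⊕ B) 0 ≢ + 0
    A₀+B₀≢0 rewrite ⊕-coefficient A B 0 | A₀ | B₀ = λ ()

  col : PS2 → ℕ → PS
  col A k n = A n k

  *₁≡⊗ : ∀ A B n → (A *₁ B) n ≡ (A ⊗ B) n
  *₁≡⊗ A B n = trans (sumTo≡σ n _) (sym (⊗-coefficient A B n))

  *₂-columns : ∀ A B n k → (A *₂ B) n k ≡ σ k (λ b → (col A b ⊗ col B (k ∸ b)) n)
  *₂-columns A B n k = begin
    (A *₂ B) n k
      ≡⟨ trans (sumTo≡σ n _) (σ-cong n (λ a _ → sumTo≡σ k _)) ⟩
    σ n (λ a → σ k (λ b → A a b * B (n ∸ a) (k ∸ b)))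
      ≡⟨ σ-swap n k _ ⟩
    σ k (λ b → σ n (λ a → A a b * B (n ∸ a) (k ∸ b)))
      ≡⟨ σ-cong k (λ b _ → ⊗-coefficient (col A b) (col B (k ∸ b)) n) ⟨
    σ k (λ b → (col A b ⊗ col B (k ∸ b)) n)
      ∎
    where open ≡-Reasoning

module GeneratingFunctions where

  open PowerSeries
  open Counting using (previous; iNK-rec; intervals-rec)
  open import Data.Integer as ℤ using (+_; _+_; _*_; -_)
  import Data.Integer.Properties as ℤ
  open import Data.Integer.Tactic.RingSolver using (solve-∀)
  open import Data.Nat as ℕ using (ℕ; zero; suc; _∸_; _<_; s≤s)
  open import Data.Nat.Induction using (<-rec)
  import Data.Nat.Properties as ℕ
  import Relation.Binary.Reasoning.Setoid ≈-setoid as ≈-Reasoning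

  ⓪ ① ② ③ ④ : ∀ {m} → Polynomial m
  ⓪ = con (+ 0)
  ① = con (+ 1)
  ② = con (+ 2)
  ③ = con (+ 3)
  ④ = con (+ 4)

  atZero : PS → ℕ → PS
  atZero A zero    = A
  atZero A (suc k) = 𝟎

  recurrence : (ℕ → PS) → (ℕ → PS) → ℕ → PS
  recurrence F Y k = F k ⊕ Y k ⊕ Y k ⊕ Y (suc k) ⊕ previous 𝟎 Y k

  opaque
    unfolding _⊕_

    recurrence-coefficient : ∀ F Y k n →
      recurrence F Y k n ≡ F k n + Y k n + Y k n + Y (suc k) n + previous 𝟎 Y k n
    recurrence-coefficient F Y k n = refl

  -- Yₖ = x (Fₖ + 2 Yₖ + Yₖ₊₁ + Yₖ₋₁) with Y₋₁ = 0: the coefficient of xⁿ⁺¹ is given by those of xⁿ.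
  Solves : (ℕ → PS) → (ℕ → PS) → Set
  Solves F Y = ∀ k → Y k ≈ X ⊗ recurrence F Y k

  solution-unique : ∀ F Y Z → Solves F Y → Solves F Z → ∀ k → Y k ≈ Z k
  solution-unique F Y Z Y-solves Z-solves k n = coefficient n k
    where
    open ≡-Reasoning
    coefficient : ∀ n k → Y k n ≡ Z k n
    coefficient zero    k = trans (trans (Y-solves k 0) (X⊗-zero _)) (sym (trans (Z-solves k 0) (X⊗-zero _)))
    coefficient (suc n) k = begin
      Y k (suc n)
        ≡⟨ trans (Y-solves k (suc n)) (trans (X⊗-suc (recurrence F Y k) n) (recurrence-coefficient F Y k n)) ⟩
      F k n + Y k n + Y k n + Y (suc k) n + previous 𝟎 Y k n
        ≡⟨ cong₂ (λ a b → F k n + a + a + b + previous 𝟎 Y k n) (coefficient n k) (coefficient n (suc k)) ⟩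
      F k n + Z k n + Z k n + Z (suc k) n + previous 𝟎 Y k n
        ≡⟨ cong (λ b → F k n + Z k n + Z k n + Z (suc k) n + b) (previous-coefficient k) ⟩
      F k n + Z k n + Z k n + Z (suc k) n + previous 𝟎 Z k n
        ≡⟨ trans (Z-solves k (suc n)) (trans (X⊗-suc (recurrence F Z k) n) (recurrence-coefficient F Z k n)) ⟨
      Z k (suc n)
        ∎
      where
      previous-coefficient : ∀ k → previous 𝟎 Y k n ≡ previous 𝟎 Z k n
      previous-coefficient zero    = refl
      previous-coefficient (suc k) = coefficient n k

  column : ℕ → PS
  column = col iSeriesMinus1

  column-zero : ∀ k → column k 0 ≡ + 0
  column-zero zero    = refl
  column-zero (suc k) = refl

  columns-solve : Solves (atZero 𝟏) column
  columns-solve k zero    = trans (column-zero k) (sym (X⊗-zero _))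
  columns-solve k (suc n) = trans (coefficient k n)
    (sym (trans (X⊗-suc (recurrence (atZero 𝟏) column k) n) (recurrence-coefficient (atZero 𝟏) column k n)))
    where
    open ≡-Reasoning
    coefficient : ∀ k n → column k (suc n) ≡
                  atZero 𝟏 k n + column k n + column k n + column (suc k) n + previous 𝟎 column k n
    coefficient zero    zero    = refl
    coefficient (suc k) zero    rewrite column-zero k = refl
    coefficient k       (suc m) = begin
      + iNK (suc (suc m)) k
        ≡⟨ cong +_ (iNK-rec m k) ⟩
      + (a k ℕ.+ a k ℕ.+ a (suc k) ℕ.+ previous 0 a k)
        ≡⟨ trans (ℤ.pos-+ _ (previous 0 a k)) (cong (_+ + previous 0 a k)
             (trans (ℤ.pos-+ _ (a (suc k))) (cong (_+ + a (suc k)) (ℤ.pos-+ (a k) (a k))))) ⟩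
      + a k + + a k + + a (suc k) + + previous 0 a k
        ≡⟨ cong₂ (λ z b → z + + a k + + a k + + a (suc k) + b) (no-forcing k) (previous-column k) ⟨
      atZero 𝟏 k (suc m) + column k (suc m) + column k (suc m) + column (suc k) (suc m) + previous 𝟎 column k (suc m)
        ∎
      where
      a = iNK (suc m)
      no-forcing : ∀ k → atZero 𝟏 k (suc m) ≡ + 0
      no-forcing zero    = refl
      no-forcing (suc k) = refl
      previous-column : ∀ k → previous 𝟎 column k (suc m) ≡ + previous 0 a k
      previous-column zero    = refl
      previous-column (suc k) = refl

  -- By catalan-equation this is C(x) − 1 for the Catalan series C.
  catalan : PS
  catalan = column 0

  -- Both families solve the system with forcing term catalan at k = 0.
  column-suc : ∀ k → column (suc k) ≈ catalan ⊗ column k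
  column-suc = solution-unique (atZero catalan) (λ k → column (suc k)) (λ k → catalan ⊗ column k) shifted multiplied
    where
    open ≈-Reasoning
    shifted : Solves (atZero catalan) (λ k → column (suc k))
    shifted k = ≈-trans (columns-solve (suc k)) (⊗-cong ≈-refl (forcing k))
      where
      forcing : ∀ k → recurrence (atZero 𝟏) column (suc k) ≈ recurrence (atZero catalan) (λ k → column (suc k)) k
      forcing zero    n = trans (recurrence-coefficient (atZero 𝟏) column 1 n)
        (trans (swap (column 1 n) (column 2 n) (column 0 n))
               (sym (recurrence-coefficient (atZero catalan) (λ k → column (suc k)) 0 n)))
        where
        swap : ∀ a b c → + 0 + a + a + b + c ≡ c + a + a + b + + 0
        swap = solve-∀
      forcing (suc k) = ≈-refl
    multiplied : Solves (atZero catalan) (λ k → catalan ⊗ column k)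
    multiplied k = begin
      catalan ⊗ column k
        ≈⟨ ⊗-cong ≈-refl (columns-solve k) ⟩
      catalan ⊗ (X ⊗ (atZero 𝟏 k ⊕ column k ⊕ column k ⊕ column (suc k) ⊕ previous 𝟎 column k))
        ≈⟨ solve 6 (λ c x a b d e → c :* (x :* (a :+ b :+ b :+ d :+ e))
                                 := x :* (c :* a :+ c :* b :+ c :* b :+ c :* d :+ c :* e))
             (λ _ → refl) catalan X (atZero 𝟏 k) (column k) (column (suc k)) (previous 𝟎 column k) ⟩
      X ⊗ (catalan ⊗ atZero 𝟏 k ⊕ catalan ⊗ column k ⊕ catalan ⊗ column k ⊕ catalan ⊗ column (suc k)
             ⊕ catalan ⊗ previous 𝟎 column k)
        ≈⟨ ⊗-cong ≈-refl
             (⊕-cong (⊕-cong (⊕-cong (⊕-cong (forcing k) ≈-refl) ≈-refl) ≈-refl) (previous-product k)) ⟩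
      X ⊗ recurrence (atZero catalan) (λ k → catalan ⊗ column k) k
        ∎
      where
      forcing : ∀ k → catalan ⊗ atZero 𝟏 k ≈ atZero catalan k
      forcing zero    = ⊗-identityʳ catalan
      forcing (suc k) = ⊗-zeroʳ catalan
      previous-product : ∀ k → catalan ⊗ previous 𝟎 column k ≈ previous 𝟎 (λ k → catalan ⊗ column k) k
      previous-product zero    = ⊗-zeroʳ catalan
      previous-product (suc k) = ≈-refl

  catalan-equation : catalan ≈ X ⊗ (𝟏 ⊕ catalan) ⊗ (𝟏 ⊕ catalan)
  catalan-equation = begin
    catalan
      ≈⟨ columns-solve 0 ⟩
    X ⊗ (𝟏 ⊕ catalan ⊕ catalan ⊕ column 1 ⊕ 𝟎)
      ≈⟨ ⊗-cong ≈-refl (⊕-cong (⊕-cong ≈-refl (column-suc 0)) (≈-sym constant-zero)) ⟩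
    X ⊗ (𝟏 ⊕ catalan ⊕ catalan ⊕ catalan ⊗ catalan ⊕ constant (+ 0))
      ≈⟨ solve 2 (λ c x → x :* (① :+ c :+ c :+ c :* c :+ ⓪) := x :* (① :+ c) :* (① :+ c))
           (λ _ → refl) catalan X ⟩
    X ⊗ (𝟏 ⊕ catalan) ⊗ (𝟏 ⊕ catalan)
      ∎
    where open ≈-Reasoning

  𝟐 𝟑 𝟒 : PS
  𝟐 = constant (+ 2)
  𝟑 = constant (+ 3)
  𝟒 = constant (+ 4)

  √1-4x : PS
  √1-4x = 𝟏 ⊖ 𝟐 ⊗ X ⊖ 𝟐 ⊗ X ⊗ catalan

  opaque
    unfolding _⊕_ ⊖_ _⊗_

    √1-4x-at-0 : √1-4x 0 ≡ + 1
    √1-4x-at-0 = refl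

  √1-4x-squared : √1-4x ⊗ √1-4x ≈ 𝟏 ⊖ 𝟒 ⊗ X
  √1-4x-squared = begin
    √1-4x ⊗ √1-4x
      ≈⟨ solve 2 (λ c x → (① :- ② :* x :- ② :* x :* c) :* (① :- ② :* x :- ② :* x :* c)
                       := ① :- ④ :* x :+ ④ :* x :* (x :* (① :+ c) :* (① :+ c) :- c))
           (λ _ → refl) catalan X ⟩
    𝟏 ⊖ 𝟒 ⊗ X ⊕ 𝟒 ⊗ X ⊗ (X ⊗ (𝟏 ⊕ catalan) ⊗ (𝟏 ⊕ catalan) ⊖ catalan)
      ≈⟨ ⊕-cong ≈-refl (⊗-cong ≈-refl (⊕-cong (≈-sym catalan-equation) ≈-refl)) ⟩
    𝟏 ⊖ 𝟒 ⊗ X ⊕ 𝟒 ⊗ X ⊗ (catalan ⊖ catalan)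
      ≈⟨ solve 2 (λ c x → ① :- ④ :* x :+ ④ :* x :* (c :- c) := ① :- ④ :* x)
           (λ _ → refl) catalan X ⟩
    𝟏 ⊖ 𝟒 ⊗ X
      ∎
    where open ≈-Reasoning

  square-root : ∀ s → s 0 ≡ + 1 → s ⊗ s ≈ 𝟏 ⊖ 𝟒 ⊗ X → s ≈ √1-4x
  square-root s s₀ s² = sqrt-unique s √1-4x s₀ √1-4x-at-0 (≈-trans s² (≈-sym √1-4x-squared))

  catalan⊗denominator : catalan ⊗ (𝟏 ⊖ 𝟐 ⊗ X ⊕ √1-4x) ≈ 𝟐 ⊗ X
  catalan⊗denominator = begin
    catalan ⊗ (𝟏 ⊖ 𝟐 ⊗ X ⊕ √1-4x)
      ≈⟨ solve 2 (λ c x → c :* (① :- ② :* x :+ (① :- ② :* x :- ② :* x :* c))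
                       := ② :* x :+ ② :* (c :- x :* (① :+ c) :* (① :+ c)))
           (λ _ → refl) catalan X ⟩
    𝟐 ⊗ X ⊕ 𝟐 ⊗ (catalan ⊖ X ⊗ (𝟏 ⊕ catalan) ⊗ (𝟏 ⊕ catalan))
      ≈⟨ ⊕-cong ≈-refl (⊗-cong ≈-refl (⊕-cong catalan-equation ≈-refl)) ⟩
    𝟐 ⊗ X ⊕ 𝟐 ⊗ (X ⊗ (𝟏 ⊕ catalan) ⊗ (𝟏 ⊕ catalan) ⊖ X ⊗ (𝟏 ⊕ catalan) ⊗ (𝟏 ⊕ catalan))
      ≈⟨ solve 2 (λ c x → ② :* x :+ ② :* (x :* (① :+ c) :* (① :+ c) :- x :* (① :+ c) :* (① :+ c))
                       := ② :* x)
           (λ _ → refl) catalan X ⟩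
    𝟐 ⊗ X
      ∎
    where open ≈-Reasoning

  column⊗denominator : ∀ k → column k ⊗ ⊖ (𝟐 ⊗ X) ⊕ column (suc k) ⊗ (𝟏 ⊖ 𝟐 ⊗ X ⊕ √1-4x) ≈ 𝟎
  column⊗denominator k = begin
    column k ⊗ ⊖ (𝟐 ⊗ X) ⊕ column (suc k) ⊗ (𝟏 ⊖ 𝟐 ⊗ X ⊕ √1-4x)
      ≈⟨ ⊕-cong ≈-refl (⊗-cong (column-suc k) ≈-refl) ⟩
    column k ⊗ ⊖ (𝟐 ⊗ X) ⊕ catalan ⊗ column k ⊗ (𝟏 ⊖ 𝟐 ⊗ X ⊕ √1-4x)
      ≈⟨ solve 4 (λ r c d x → r :* (:- (② :* x)) :+ c :* r :* d := r :* (c :* d :- ② :* x))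
           (λ _ → refl) (column k) catalan (𝟏 ⊖ 𝟐 ⊗ X ⊕ √1-4x) X ⟩
    column k ⊗ (catalan ⊗ (𝟏 ⊖ 𝟐 ⊗ X ⊕ √1-4x) ⊖ 𝟐 ⊗ X)
      ≈⟨ ⊗-cong ≈-refl (⊕-cong catalan⊗denominator ≈-refl) ⟩
    column k ⊗ (𝟐 ⊗ X ⊖ 𝟐 ⊗ X)
      ≈⟨ solve 2 (λ r x → r :* (② :* x :- ② :* x) := ⓪) (λ _ → refl) (column k) X ⟩
    constant (+ 0)
      ≈⟨ constant-zero ⟩
    𝟎
      ∎
    where open ≈-Reasoning

  oneMinus4x≈ : oneMinus4x ≈ 𝟏 ⊖ 𝟒 ⊗ X
  oneMinus4x≈ n = sym (trans (𝟏⊖cX-coefficient (+ 4) n) (values n))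
    where
    values : ∀ n → 𝟏 n ℤ.- + 4 * X n ≡ oneMinus4x n
    values zero          = refl
    values (suc zero)    = refl
    values (suc (suc n)) = refl

  module Bivariate (S : PS2) (S₀₀ : S 0 0 ≡ + 1) (S² : (S *₂ S) ≈₂ oneMinus4x₂) where

    s : PS
    s = col S 0

    s² : s ⊗ s ≈ 𝟏 ⊖ 𝟒 ⊗ X
    s² n = trans (sym (*₂-columns S S n 0)) (trans (S² n 0) (trans (y⁰ n) (oneMinus4x≈ n)))
      where
      y⁰ : ∀ n → oneMinus4x₂ n 0 ≡ oneMinus4x n
      y⁰ zero          = refl
      y⁰ (suc zero)    = refl
      y⁰ (suc (suc n)) = refl

    -- Once the columns 1, …, k vanish, column k + 1 of S² is 2 S₀ S_{k+1}.
    higher-columns-vanish : ∀ k → col S (suc k) ≈ 𝟎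
    higher-columns-vanish = <-rec (λ k → col S (suc k) ≈ 𝟎) step
      where
      step : ∀ k → (∀ {j} → j < k → col S (suc j) ≈ 𝟎) → col S (suc k) ≈ 𝟎
      step k lower-vanish = ⊗-cancel (s ⊕ s) (col S (suc k)) 2≢0 (λ n → begin
        (col S (suc k) ⊗ (s ⊕ s)) n
          ≡⟨ solve 2 (λ s t → t :* (s :+ s) := s :* t :+ t :* s) (λ _ → refl) s (col S (suc k)) n ⟩
        (s ⊗ col S (suc k) ⊕ col S (suc k) ⊗ s) n
          ≡⟨ ⊕-coefficient _ _ n ⟩
        (s ⊗ col S (suc k)) n + (col S (suc k) ⊗ s) n
          ≡⟨ cong (λ x → (s ⊗ col S (suc k)) n + x) (middle-terms n) ⟨
        (s ⊗ col S (suc k)) n + σ k (λ b → (col S (suc b) ⊗ col S (k ∸ b)) n)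
          ≡⟨ *₂-columns S S n (suc k) ⟨
        (S *₂ S) n (suc k)
          ≡⟨ S² n (suc k) ⟩
        oneMinus4x₂ n (suc k)
          ≡⟨ no-y n ⟩
        + 0
          ∎)
        where
        open ≡-Reasoning
        2≢0 : (s ⊕ s) 0 ≢ + 0
        2≢0 rewrite ⊕-coefficient s s 0 | S₀₀ = λ ()
        middle-terms : ∀ n → σ k (λ b → (col S (suc b) ⊗ col S (k ∸ b)) n) ≡ (col S (suc k) ⊗ s) n
        middle-terms n = trans (σ-only-last k _ (λ b b<k → trans (⊗-cong (lower-vanish b<k) ≈-refl n) (⊗-zeroˡ _ n)))
                               (cong (λ j → (col S (suc k) ⊗ col S j) n) (ℕ.n∸n≡0 k))
        no-y : ∀ n → oneMinus4x₂ n (suc k) ≡ + 0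
        no-y zero          = refl
        no-y (suc zero)    = refl
        no-y (suc (suc n)) = refl

    Q : PS2
    Q n k = poly1 n k + S n k

    Q₀ : col Q 0 ≈ 𝟏 ⊖ 𝟐 ⊗ X ⊕ √1-4x
    Q₀ n = trans (cong₂ _+_ (sym (trans (𝟏⊖cX-coefficient (+ 2) n) (values n))) (square-root s S₀₀ s² n))
                 (sym (⊕-coefficient _ _ n))
      where
      values : ∀ n → 𝟏 n ℤ.- + 2 * X n ≡ poly1 n 0
      values zero          = refl
      values (suc zero)    = refl
      values (suc (suc n)) = refl

    Q₁ : col Q 1 ≈ ⊖ (𝟐 ⊗ X)
    Q₁ n = trans (cong₂ _+_ (sym (trans (neg-coefficient _ n) (trans (cong -_ (constant-⊗ (+ 2) X n)) (values n))))
                            (higher-columns-vanish 0 n))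
                 (ℤ.+-identityʳ _)
      where
      values : ∀ n → - (+ 2 * X n) ≡ poly1 n 1
      values zero          = refl
      values (suc zero)    = refl
      values (suc (suc n)) = refl

    Q₂ : ∀ k → col Q (suc (suc k)) ≈ 𝟎
    Q₂ k n = cong₂ _+_ (no-y² n) (higher-columns-vanish (suc k) n)
      where
      no-y² : ∀ n → poly1 n (suc (suc k)) ≡ + 0
      no-y² zero          = refl
      no-y² (suc zero)    = refl
      no-y² (suc (suc n)) = refl

    product-columns : ∀ k n → σ k (λ b → (column b ⊗ col Q (k ∸ b)) n) ≡ twoX n k
    product-columns zero    n =
      trans (⊗-cong ≈-refl Q₀ n) (trans (catalan⊗denominator n) (trans (constant-⊗ (+ 2) X n) (values n)))
      where
      values : ∀ n → + 2 * X n ≡ twoX n 0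
      values zero          = refl
      values (suc zero)    = refl
      values (suc (suc n)) = refl
    product-columns (suc k) n = begin
      σ (suc k) (λ b → (column b ⊗ col Q (suc k ∸ b)) n)
        ≡⟨ σ-last k _ ⟩
      σ k (λ b → (column b ⊗ col Q (suc k ∸ b)) n) + (column (suc k) ⊗ col Q (k ∸ k)) n
        ≡⟨ cong₂ _+_ (σ-only-last k _ far) (cong (λ i → (column (suc k) ⊗ col Q i) n) (ℕ.n∸n≡0 k)) ⟩
      (column k ⊗ col Q (suc k ∸ k)) n + (column (suc k) ⊗ col Q 0) n
        ≡⟨ cong (λ i → (column k ⊗ col Q i) n + (column (suc k) ⊗ col Q 0) n) (suc-k∸k k) ⟩
      (column k ⊗ col Q 1) n + (column (suc k) ⊗ col Q 0) n
        ≡⟨ ⊕-coefficient _ _ n ⟨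
      (column k ⊗ col Q 1 ⊕ column (suc k) ⊗ col Q 0) n
        ≡⟨ trans (⊕-cong (⊗-cong ≈-refl Q₁) (⊗-cong ≈-refl Q₀) n) (column⊗denominator k n) ⟩
      + 0
        ≡⟨ no-y n ⟨
      twoX n (suc k)
        ∎
      where
      open ≡-Reasoning
      suc-k∸k : ∀ k → suc k ∸ k ≡ 1
      suc-k∸k zero    = refl
      suc-k∸k (suc k) = suc-k∸k k
      far : ∀ b → b < k → (column b ⊗ col Q (suc k ∸ b)) n ≡ + 0
      far b b<k = trans (⊗-cong ≈-refl (λ n → trans (cong (λ i → col Q i n) (gap b k b<k)) (Q₂ _ n)) n)
                        (⊗-zeroʳ (column b) n)
        where
        gap : ∀ b k → b < k → suc k ∸ b ≡ suc (suc (k ∸ suc b))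
        gap zero    (suc k) _         = refl
        gap (suc b) (suc k) (s≤s b<k) = gap b k b<k
      no-y : ∀ n → twoX n (suc k) ≡ + 0
      no-y zero          = refl
      no-y (suc zero)    = refl
      no-y (suc (suc n)) = refl

    iNK-generating-function : (iSeriesMinus1 *₂ Q) ≈₂ twoX
    iNK-generating-function n k = trans (*₂-columns iSeriesMinus1 Q n k) (product-columns k n)

  intervals-equation : (𝟏 ⊖ 𝟒 ⊗ X) ⊗ intervalSeries ≈ 𝟏 ⊖ 𝟑 ⊗ X ⊖ X ⊗ catalan
  intervals-equation n = begin
    ((𝟏 ⊖ 𝟒 ⊗ X) ⊗ T) n
      ≡⟨ solve 2 (λ x j → (① :- ④ :* x) :* j := j :- ④ :* (x :* j)) (λ _ → refl) X T n ⟩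
    (T ⊖ 𝟒 ⊗ (X ⊗ T)) n
      ≡⟨ trans (⊖-coefficient _ _ n) (cong (λ x → T n ℤ.- x) (constant-⊗ (+ 4) (X ⊗ T) n)) ⟩
    T n ℤ.- + 4 * (X ⊗ T) n
      ≡⟨ values n ⟩
    𝟏 n ℤ.- + 3 * X n ℤ.- (X ⊗ catalan) n
      ≡⟨ trans (⊖-coefficient _ _ n)
           (cong (ℤ._- (X ⊗ catalan) n) (𝟏⊖cX-coefficient (+ 3) n)) ⟨
    (𝟏 ⊖ 𝟑 ⊗ X ⊖ X ⊗ catalan) n
      ∎
    where
    open ≡-Reasoning
    T = intervalSeries
    values : ∀ n → T n ℤ.- + 4 * (X ⊗ T) n ≡ 𝟏 n ℤ.- + 3 * X n ℤ.- (X ⊗ catalan) n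
    values zero          rewrite X⊗-zero T | X⊗-zero catalan = refl
    values (suc zero)    rewrite X⊗-suc T 0 | X⊗-suc catalan 0 = refl
    values (suc (suc m)) rewrite X⊗-suc T (suc m) | X⊗-suc catalan (suc m) = begin
      + I₂ ℤ.- + 4 * + I₁     ≡⟨ cong (λ x → + I₂ ℤ.- x) (trans (cong +_ (intervals-rec m)) (ℤ.pos-* 4 I₁)) ⟨
      + I₂ ℤ.- + (I₂ ℕ.+ G)   ≡⟨ cong (λ x → + I₂ ℤ.- x) (ℤ.pos-+ I₂ G) ⟩
      + I₂ ℤ.- (+ I₂ + + G)   ≡⟨ cancel (+ I₂) (+ G) ⟩
      + 0 ℤ.- + 3 * + 0 ℤ.- + G  ∎
      where
      I₁ = intervals (suc m)
      I₂ = intervals (suc (suc m))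
      G  = iNK (suc m) 0
      cancel : ∀ a g → a ℤ.- (a + g) ≡ + 0 ℤ.- + 3 * + 0 ℤ.- g
      cancel = solve-∀

  module Univariate (S : PS) (S₀ : S 0 ≡ + 1) (S² : (S *₁ S) ≈₁ oneMinus4x) where

    s² : S ⊗ S ≈ 𝟏 ⊖ 𝟒 ⊗ X
    s² n = trans (sym (*₁≡⊗ S S n)) (trans (S² n) (oneMinus4x≈ n))

    -- Multiplied by S, the claim becomes 2 (1 − 4x) J = S + S²; then S is cancelled.
    times-S : S ⊗ ((𝟐 ⊗ intervalSeries) ⊗ S) ≈ S ⊗ (S ⊕ 𝟏)
    times-S = begin
      S ⊗ ((𝟐 ⊗ T) ⊗ S)
        ≈⟨ solve 2 (λ s j → s :* ((② :* j) :* s) := (② :* j) :* (s :* s)) (λ _ → refl) S T ⟩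
      (𝟐 ⊗ T) ⊗ (S ⊗ S)
        ≈⟨ ⊗-cong ≈-refl s² ⟩
      (𝟐 ⊗ T) ⊗ (𝟏 ⊖ 𝟒 ⊗ X)
        ≈⟨ solve 2 (λ j x → (② :* j) :* (① :- ④ :* x) := ② :* ((① :- ④ :* x) :* j))
             (λ _ → refl) T X ⟩
      𝟐 ⊗ ((𝟏 ⊖ 𝟒 ⊗ X) ⊗ T)
        ≈⟨ ⊗-cong ≈-refl intervals-equation ⟩
      𝟐 ⊗ (𝟏 ⊖ 𝟑 ⊗ X ⊖ X ⊗ catalan)
        ≈⟨ solve 2 (λ x c → ② :* (① :- ③ :* x :- x :* c)
                         := (① :- ② :* x :- ② :* x :* c) :+ (① :- ④ :* x))
             (λ _ → refl) X catalan ⟩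
      √1-4x ⊕ (𝟏 ⊖ 𝟒 ⊗ X)
        ≈⟨ ⊕-cong (≈-sym (square-root S S₀ s²)) (≈-sym s²) ⟩
      S ⊕ S ⊗ S
        ≈⟨ solve 1 (λ s → s :+ s :* s := s :* (s :+ ①)) (λ _ → refl) S ⟩
      S ⊗ (S ⊕ 𝟏)
        ∎
      where
      open ≈-Reasoning
      T = intervalSeries

    intervals-generating-function : ((λ n → + 2 * intervalSeries n) *₁ S) ≈₁ (λ n → S n + if0 n)
    intervals-generating-function n = begin
      ((λ n → + 2 * T n) *₁ S) n   ≡⟨ *₁≡⊗ _ S n ⟩
      ((λ n → + 2 * T n) ⊗ S) n   ≡⟨ ⊗-cong (λ n → sym (constant-⊗ (+ 2) T n)) ≈-refl n ⟩
      ((𝟐 ⊗ T) ⊗ S) n              ≡⟨ ⊗-cancelˡ S _ _ S₀≢0 times-S n ⟩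
      (S ⊕ 𝟏) n                    ≡⟨ trans (⊕-coefficient S 𝟏 n) (cong (λ x → S n + x) (𝟏≡if0 n)) ⟩
      S n + if0 n                  ∎
      where
      open ≡-Reasoning
      T = intervalSeries
      S₀≢0 : S 0 ≢ + 0
      S₀≢0 rewrite S₀ = λ ()
      𝟏≡if0 : ∀ n → 𝟏 n ≡ if0 n
      𝟏≡if0 zero    = refl
      𝟏≡if0 (suc n) = refl


open import Data.Nat using (ℕ; _≤_; _+_; _∸_)
open import Data.Nat.Combinatorics using (_C_)
open import Data.Integer as ℤ using (ℤ; +_)
open import Data.Product using (_×_; _,_)
open Ballot using (intervals-binomial)
open GeneratingFunctions using (module Bivariate; module Univariate)

theorem4p5 :
    -- Σ i_{n,k} x^n y^k = 1 + 2x / (1 - 2x - 2xy + √(1-4x)),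
    -- i.e. (I - 1)·(1 - 2x - 2xy + S) = 2x for S the square root of 1-4x with S(0,0) = 1
    ((S : PS2) → S 0 0 ≡ + 1 → (S *₂ S) ≈₂ oneMinus4x₂ →
      (iSeriesMinus1 *₂ (λ n k → poly1 n k ℤ.+ S n k)) ≈₂ twoX)
    -- Σ (#intervals) x^n = (1 + 1/√(1-4x))/2, i.e. 2·J·S = S + 1
    × ((S : PS1) → S 0 ≡ + 1 → (S *₁ S) ≈₁ oneMinus4x →
      ((λ n → + 2 ℤ.* intervalSeries n) *₁ S) ≈₁ (λ n → S n ℤ.+ (if0 n)))
    -- for n ≥ 1 the number of intervals is binom(2n-1, n)
    × ((n : ℕ) → 1 ≤ n → intervals n ≡ (n + n ∸ 1) C n)
theorem4p5 = Bivariate.iNK-generating-function , Univariate.intervals-generating-function , intervals-binomial
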